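{- Let $\ell\ge2$, let $D=(b|g;f_1,\dots,f_\ell)=(d_{n,k})_{n,k\ge0}$ be a multiple almost-Riordan array with $b(t)=\sum_{k}b_{\ell k}t^{\ell k}$, $g(t)=\sum_kg_{\ell k}t^{\ell k}$, $f_j(t)=\sum_kf_{j,\ell k+1}t^{\ell k+1}$, $c_j:=f_{j,1}=[t]f_j$, and let $\hat b(t)=\sum_kb_{\ell k}t^k$, $\hat g(t)=\sum_kg_{\ell k}t^k$, $\hat f_j(t)=\sum_kf_{j,\ell k+1}t^{k+1}$. Let $(\hat d_{n,k})$ be the compression of $D$, $\hat d_{n,k}=d_{\ell n-(\ell-1)k,\,k}$ (with $d_{N,k}=0$ for $N<0$). Let $A=(a_k)$, $Z_j=(z_{j,k})$ ($j=1,\dots,\ell$), $W=(w_k)$ be the $A$-, $Z_j$-, $W$-sequences of $D$, and write their generating functions as $A(t)=\alpha(t^\ell)$, $Z_j(t)=\zeta_j(t^\ell)$, $W(t)=\omega(t^\ell)$ with $\alpha(x)=\sum_ka_kx^k$, $\zeta_j(x)=\sum_kz_{j,k}x^k$, $\omega(x)=\sum_kw_kx^k$. Put $\hat F=\hat f_1\hat f_2\cdots\hat f_\ell$ and $X(t)=\hat F(t)/t^{\ell-1}$. Then $$\alpha(X)=\frac{\hat F}{t^\ell},\qquad \zeta_1(X)=\frac1t\Bigl(1-\frac{g_0}{\hat g}\Bigr),$$ $$\zeta_m(X)=\frac1t\Bigl(1-\frac{g_0c_1c_2\cdots c_{m-1}\,t^{m-1}}{\hat g\,\hat f_1\hat f_2\cdots\hat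 f_{m-1}}\Bigr)\quad(m=2,\dots,\ell-1),$$ $$\zeta_\ell(X)=\frac{\hat f_\ell}{t^\ell\hat g}\bigl(\hat g\hat f_1\cdots\hat f_{\ell-1}-z_{\ell,0}t^{\ell-1}\hat b\bigr)+z_{\ell,0},\qquad z_{\ell,0}=\frac{g_0c_1\cdots c_{\ell-1}}{b_0},$$ $$\omega(X)=\frac{\hat f_\ell}{t^2\hat g}\bigl(\hat b(1-w_0t)-b_0\bigr)+w_0,\qquad w_0=\frac{b_\ell}{b_0};$$ equivalently, the compression satisfies $\hat d_{n,k}=\sum_{j\ge0}a_j\hat d_{n-\ell+j(\ell-1),\,k+\ell(j-1)}$ for $k>\ell$, $n\ge k$; $\hat d_{n,\ell}=\sum_{j\ge0}z_{\ell,j}\hat d_{n-\ell+j(\ell-1),\,j\ell}$ for $n\ge\ell$; $\hat d_{n,m}=\sum_{j\ge0}z_{m,j}\hat d_{n-1+j(\ell-1),\,j\ell+m}$ for $1\le m\le\ell-1$, $n\ge m+1$; $\hat d_{n,0}=\sum_{j\ge0}w_j\hat d_{n-1+j(\ell-1),\,j\ell}$ for $n\ge1$.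
   Context: Fix an integer $\ell\ge2$ and a field $\mathbb K$ of characteristic $0$; $\mathbb K[[t^\ell]]$ denotes the formal power series in $t^\ell$. For $b,g\in\mathbb K[[t^\ell]]$ with $b_0:=b(0)\ne0$, $g_0:=g(0)\ne0$, $b_\ell:=[t^\ell]b$, and $f_1,\dots,f_\ell\in t\mathbb K[[t^\ell]]$ with nonzero coefficient of $t$, the multiple almost-Riordan array $(b|g;f_1,\dots,f_\ell)$ is the infinite lower triangular matrix $(d_{n,k})_{n,k\ge0}$ with $d_{n,0}=[t^n]b(t)$ and, for $k\ge1$, $d_{n,k}=[t^n]\,t\,g\,f_1^{e_1(k)}\cdots f_\ell^{e_\ell(k)}$ with $e_i(k)=\lfloor (k-1+\ell-i)/\ell\rfloor$ (columns $b, tg, tgf_1, tgf_1f_2,\dots,tgf_1\cdots f_\ell, tgf_1^2f_2\cdots f_\ell,\dots$). Its $A$-, $Z_j$- and $W$-sequences are the sequences satisfying, for all $n\ge0$ (entries $d_{n,k}$ with $k>n$ being $0$): $d_{n+\ell,k}=\sum_{j\ge0}a_jd_{n,k-\ell+\ell j}$ for $k>\ell$; $d_{n+\ell,m}=\sum_{j\ge0}z_{m,j}d_{n,m+\ell j}$ for $1\le m\le\ell-1$; $d_{n+\ell,\ell}=\sum_{j\ge0}z_{\ell,j}d_{n,\ell j}$; $d_{n+\ell,0}=\sum_{j\ge0}w_jd_{n,\ell j}$. The paper writes $\alpha(X)$ as $A\bigl(\sqrt[\ell]{\hat f_1\cdots\hat f_\ell/t^{\ell-1}}\bigr)$, and similarly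 for $Z_j$ and $W$. -}

module Defs where

open import Level using (_⊔_)
open import Algebra.Bundles using (CommutativeRing)
open import Data.Nat using (ℕ; zero; suc; _∸_; _≡ᵇ_; _≤ᵇ_; NonZero) renaming (_+_ to _+ℕ_; _*_ to _*ℕ_; _<_ to _<ℕ_)
open import Data.Nat.DivMod using (_/_)
open import Data.Bool using (if_then_else_)
open import Data.Product using (∃)
open import Relation.Nullary using (¬_)
open import Relation.Binary.PropositionalEquality using (_≡_)

record Field c r : Set (Level.suc (c ⊔ r)) where
  field
    commutativeRing : CommutativeRing c r
  open CommutativeRing commutativeRing
  field
    0≉1     : ¬ (0# ≈ 1#)
    inverse : ∀ x → ¬ (x ≈ 0#) → ∃ λ y → x * y ≈ 1#

module Setup {c r} (R : CommutativeRing c r) where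
  open CommutativeRing R

  natMul : ℕ → Carrier
  natMul zero    = 0#
  natMul (suc n) = natMul n + 1#

  CharZero : Set r
  CharZero = ∀ n → natMul n ≈ 0# → n ≡ 0

  Series : Set c
  Series = ℕ → Carrier

  infix 4 _≋_
  _≋_ : Series → Series → Set r
  f ≋ g = ∀ n → f n ≈ g n

  Σ< : ℕ → (ℕ → Carrier) → Carrier
  Σ< zero    f = 0#
  Σ< (suc n) f = Σ< n f + f n

  Π< : ℕ → (ℕ → Carrier) → Carrier
  Π< zero    f = 1#
  Π< (suc n) f = Π< n f * f n

  infixl 7 _⊛_
  infixl 6 _⊕_ _⊖_
  _⊛_ : Series → Series → Series
  (f ⊛ g) n = Σ< (suc n) (λ i → f i * g (n ∸ i))

  _⊕_ : Series → Series → Series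
  (f ⊕ g) n = f n + g n

  _⊖_ : Series → Series → Series
  (f ⊖ g) n = f n - g n

  const : Carrier → Series
  const a zero    = a
  const a (suc n) = 0#

  one : Series
  one = const 1#

  tpow : ℕ → Series
  tpow m n = if m ≡ᵇ n then 1# else 0#

  pow : Series → ℕ → Series
  pow f zero    = one
  pow f (suc k) = f ⊛ pow f k

  ΠS : ℕ → (ℕ → Series) → Series
  ΠS zero    h = one
  ΠS (suc n) h = ΠS n h ⊛ h n

  -- composition α(X), for X with X 0 = 0 (coefficient n only involves X^k, k ≤ n)
  comp : Series → Series → Series
  comp α X n = Σ< (suc n) (λ k → α k * pow X k n)

  -- f / t^m  (exact when f has order ≥ m)
  shift : Series → ℕ → Series
  shift f m n = f (n +ℕ m)

  -- The multiple almost-Riordan array (b | g ; f_1, …, f_ℓ).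
  -- fs j (j = 0, …, ℓ-1) is the paper's f_{j+1}.
  module Array (ℓ : ℕ) .{{_ : NonZero ℓ}} (b g : Series) (fs : ℕ → Series) where

    -- exponent of f_{i+1} in column k ≥ 1: ⌊(k - 1 + ℓ - (i+1))/ℓ⌋
    e : ℕ → ℕ → ℕ
    e i k = ((k +ℕ ℓ) ∸ (2 +ℕ i)) / ℓ

    column : ℕ → Series
    column zero    = b
    column (suc k) = tpow 1 ⊛ g ⊛ ΠS ℓ (λ i → pow (fs i) (e i (suc k)))

    d : ℕ → ℕ → Carrier
    d n k = column k n

    dhat : ℕ → ℕ → Carrier
    dhat n k = if ((ℓ ∸ 1) *ℕ k) ≤ᵇ (ℓ *ℕ n) then d ((ℓ *ℕ n) ∸ ((ℓ ∸ 1) *ℕ k)) k else 0#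

    b₀ g₀ : Carrier
    b₀ = b 0
    g₀ = g 0

    c' : ℕ → Carrier
    c' j = fs j 1

    bhat ghat : Series
    bhat n = b (ℓ *ℕ n)
    ghat n = g (ℓ *ℕ n)

    fhat : ℕ → Series
    fhat j zero    = 0#
    fhat j (suc n) = fs j (ℓ *ℕ n +ℕ 1)

    Fhat : Series
    Fhat = ΠS ℓ fhat

    X : Series
    X = shift Fhat (ℓ ∸ 1)

    -- Defining relations of the A-, Z_m- (m = 1..ℓ) and W-sequences.
    -- The sums over j ≥ 0 are truncated at j ≤ n: all terms with j > n
    -- vanish since d_{n,k} = 0 for k > n.
    IsASeq : Series → Set r
    IsASeq a = ∀ n k → ℓ <ℕ k →
      d (n +ℕ ℓ) k ≈ Σ< (suc n) (λ j → a j * d n ((k ∸ ℓ) +ℕ ℓ *ℕ j))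

    -- Z m for 1 ≤ m ≤ ℓ - 1
    IsZSeq : ℕ → Series → Set r
    IsZSeq m z = ∀ n → d (n +ℕ ℓ) m ≈ Σ< (suc n) (λ j → z j * d n (m +ℕ ℓ *ℕ j))

    IsZℓSeq : Series → Set r
    IsZℓSeq z = ∀ n → d (n +ℕ ℓ) ℓ ≈ Σ< (suc n) (λ j → z j * d n (ℓ *ℕ j))

    IsWSeq : Series → Set r
    IsWSeq w = ∀ n → d (n +ℕ ℓ) 0 ≈ Σ< (suc n) (λ j → w j * d n (ℓ *ℕ j))

-- Every column of D factors through F = f₁⋯f_ℓ: column r + 1 + ℓ j (0 ≤ r < ℓ) is
-- t g f₁⋯f_r · F^j. Hence the defining relation of a sequence S whose columns start at r + 1
-- says (column r + 1)/t^ℓ = (column r + 1) · S(F); for W and Z_ℓ the j = 0 term sits in column 0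
-- and contributes s₀ b instead. All series involved are dilations u(t) = û(t^ℓ) (b, g, f_j / t,
-- and F = X(t^ℓ)), up to the explicit powers of t. Dilation is injective and commutes with sums,
-- products and composition, so each relation descends to an identity between the hatted series,
-- which with denominators cleared is the stated one. The compression recurrences are the same
-- relations re-indexed through d̂_{n,k} = d_{ℓn-(ℓ-1)k,k}.

{-# OPTIONS --safe #-}
module Submission where

open import Defs
open import Algebra.Bundles using (CommutativeRing)
open import Data.Nat using (ℕ; suc; NonZero; _∸_) renaming (_+_ to _+ℕ_; _*_ to _*ℕ_; _≤_ to _≤ℕ_; _<_ to _<ℕ_)
open import Data.Nat.DivMod using (_%_)
open import Data.Product using (_×_)
open import Relation.Nullary using (¬_)
open import Relation.Binary.PropositionalEquality using (_≡_)

open import Data.Bool using (true; if_then_else_)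
open import Data.Empty using (⊥-elim)
open import Data.Nat using (zero; z≤n; s≤s; _≤?_; _<?_; _≤ᵇ_; _≟_)
import Data.Nat.Properties as ℕ
open import Data.Nat.DivMod using (_/_; m≡m%n+[m/n]*n; m%n<n; +-distrib-/-∣ʳ; m<n⇒m/n≡0; m*n/n≡m)
open import Data.Nat.Divisibility using (_∣_; _∣?_; ∣⇒≤; m∣m*n; n∣m*n; ∣m+n∣m⇒∣n; ∣m∸n∣n⇒∣m; m%n≡0⇒n∣m; divides)
open import Data.Nat.Induction using (<-rec)
open import Data.Nat.Solver using (module +-*-Solver)
open import Data.Product using (_,_; proj₁; proj₂)
open import Data.Sum using (inj₁; inj₂)
open import Function using (_∘_)
open import Relation.Nullary using (yes; no)
open import Relation.Binary.PropositionalEquality using (_≢_)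
import Relation.Binary.PropositionalEquality as P

module FiniteSums {c r} (R : CommutativeRing c r) where
  open CommutativeRing R hiding (zero)
  open Setup R
  open import Algebra.Properties.CommutativeSemigroup +-commutativeSemigroup using (interchange)
  open import Algebra.Properties.Ring ring using (-1*x≈-x)

  Σ<-congᵢ : ∀ n {f h : ℕ → Carrier} → (∀ i → i <ℕ n → f i ≈ h i) → Σ< n f ≈ Σ< n h
  Σ<-congᵢ zero    f≈h = refl
  Σ<-congᵢ (suc n) f≈h = +-cong (Σ<-congᵢ n (λ i i<n → f≈h i (ℕ.m<n⇒m<1+n i<n))) (f≈h n (ℕ.n<1+n n))

  Σ<-cong : ∀ n {f h : ℕ → Carrier} → (∀ i → f i ≈ h i) → Σ< n f ≈ Σ< n h
  Σ<-cong n f≈h = Σ<-congᵢ n (λ i _ → f≈h i)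

  Σ<-zero : ∀ n {f : ℕ → Carrier} → (∀ i → i <ℕ n → f i ≈ 0#) → Σ< n f ≈ 0#
  Σ<-zero zero    f≈0 = refl
  Σ<-zero (suc n) f≈0 =
    trans (+-cong (Σ<-zero n (λ i i<n → f≈0 i (ℕ.m<n⇒m<1+n i<n))) (f≈0 n (ℕ.n<1+n n))) (+-identityˡ 0#)

  Σ<-+ : ∀ n (f h : ℕ → Carrier) → Σ< n (λ i → f i + h i) ≈ Σ< n f + Σ< n h
  Σ<-+ zero    f h = sym (+-identityˡ 0#)
  Σ<-+ (suc n) f h = trans (+-cong (Σ<-+ n f h) refl) (interchange _ _ _ _)

  *-distribˡ-Σ< : ∀ n a (f : ℕ → Carrier) → a * Σ< n f ≈ Σ< n (λ i → a * f i)
  *-distribˡ-Σ< zero    a f = zeroʳ a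
  *-distribˡ-Σ< (suc n) a f = trans (distribˡ a _ _) (+-cong (*-distribˡ-Σ< n a f) refl)

  -‿distrib-Σ< : ∀ n (f : ℕ → Carrier) → - Σ< n f ≈ Σ< n (λ i → - f i)
  -‿distrib-Σ< n f =
    trans (sym (-1*x≈-x _)) (trans (*-distribˡ-Σ< n (- 1#) f) (Σ<-cong n (λ i → -1*x≈-x (f i))))

  Σ<-split : ∀ m n (f : ℕ → Carrier) → Σ< (m +ℕ n) f ≈ Σ< m f + Σ< n (λ i → f (m +ℕ i))
  Σ<-split m zero    f rewrite ℕ.+-identityʳ m = sym (+-identityʳ _)
  Σ<-split m (suc n) f rewrite ℕ.+-suc m n = trans (+-cong (Σ<-split m n f) refl) (+-assoc _ _ _)

  Σ<-head : ∀ n (f : ℕ → Carrier) → Σ< (suc n) f ≈ f 0 + Σ< n (λ i → f (suc i))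
  Σ<-head n f = trans (Σ<-split 1 n f) (+-cong (+-identityˡ _) refl)

  Σ<-truncate : ∀ {m n} (f : ℕ → Carrier) → m ≤ℕ n → (∀ i → m ≤ℕ i → f i ≈ 0#) → Σ< n f ≈ Σ< m f
  Σ<-truncate {m} {n} f m≤n f≈0 = P.subst (λ k → Σ< k f ≈ Σ< m f) (ℕ.m+[n∸m]≡n m≤n) (begin
    Σ< (m +ℕ (n ∸ m)) f                      ≈⟨ Σ<-split m (n ∸ m) f ⟩
    Σ< m f + Σ< (n ∸ m) (λ i → f (m +ℕ i))   ≈⟨ +-cong refl (Σ<-zero (n ∸ m) (λ i _ → f≈0 (m +ℕ i) (ℕ.m≤m+n m i))) ⟩
    Σ< m f + 0#                              ≈⟨ +-identityʳ _ ⟩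
    Σ< m f                                   ∎)
    where open import Relation.Binary.Reasoning.Setoid setoid

  Σ<-comm : ∀ m n (T : ℕ → ℕ → Carrier) → Σ< m (λ i → Σ< n (T i)) ≈ Σ< n (λ k → Σ< m (λ i → T i k))
  Σ<-comm zero    n T = sym (Σ<-zero n (λ _ _ → refl))
  Σ<-comm (suc m) n T = trans (+-cong (Σ<-comm m n T) refl) (sym (Σ<-+ n (λ k → Σ< m (λ i → T i k)) (T m)))

module SeriesRing {c r} (R : CommutativeRing c r) where
  open CommutativeRing R hiding (zero)
  open Setup R
  open FiniteSums R
  open import Relation.Binary.Reasoning.Setoid setoid

  tail : Series → Series
  tail f n = f (suc n)

  scale : Carrier → Series → Series
  scale a f n = a * f n

  ≋-refl : ∀ {f} → f ≋ f
  ≋-refl n = refl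

  ≋-sym : ∀ {f h} → f ≋ h → h ≋ f
  ≋-sym f≋h n = sym (f≋h n)

  ≋-trans : ∀ {f h k} → f ≋ h → h ≋ k → f ≋ k
  ≋-trans f≋h h≋k n = trans (f≋h n) (h≋k n)

  ⊕-cong : ∀ {f f′ h h′} → f ≋ f′ → h ≋ h′ → f ⊕ h ≋ f′ ⊕ h′
  ⊕-cong f≋f′ h≋h′ n = +-cong (f≋f′ n) (h≋h′ n)

  ⊛-cong : ∀ {f f′ h h′} → f ≋ f′ → h ≋ h′ → f ⊛ h ≋ f′ ⊛ h′
  ⊛-cong f≋f′ h≋h′ n = Σ<-cong (suc n) (λ i → *-cong (f≋f′ i) (h≋h′ (n ∸ i)))

  ⊛-coeff₀ : ∀ f h → (f ⊛ h) 0 ≈ f 0 * h 0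
  ⊛-coeff₀ f h = +-identityˡ _

  ⊛-coeff-sucˡ : ∀ f h n → (f ⊛ h) (suc n) ≈ f 0 * h (suc n) + (tail f ⊛ h) n
  ⊛-coeff-sucˡ f h n = Σ<-head (suc n) (λ i → f i * h (suc n ∸ i))

  ⊛-coeff-sucʳ : ∀ f h n → (f ⊛ h) (suc n) ≈ (f ⊛ tail h) n + f (suc n) * h 0
  ⊛-coeff-sucʳ f h n = +-cong
    (Σ<-congᵢ (suc n) (λ i i≤n → *-cong refl (reflexive (P.cong h (ℕ.+-∸-assoc 1 (ℕ.≤-pred i≤n))))))
    (*-cong refl (reflexive (P.cong h (ℕ.n∸n≡0 n))))

  ⊛-comm : ∀ f h → f ⊛ h ≋ h ⊛ f
  ⊛-comm f h zero    = +-cong refl (*-comm _ _)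
  ⊛-comm f h (suc n) = begin
    (f ⊛ h) (suc n)                         ≈⟨ ⊛-coeff-sucˡ f h n ⟩
    f 0 * h (suc n) + (tail f ⊛ h) n        ≈⟨ +-cong (*-comm _ _) (⊛-comm (tail f) h n) ⟩
    h (suc n) * f 0 + (h ⊛ tail f) n        ≈⟨ +-comm _ _ ⟩
    (h ⊛ tail f) n + h (suc n) * f 0        ≈⟨ ⊛-coeff-sucʳ h f n ⟨
    (h ⊛ f) (suc n)                         ∎

  ⊛-distribˡ : ∀ f h k → f ⊛ (h ⊕ k) ≋ (f ⊛ h) ⊕ (f ⊛ k)
  ⊛-distribˡ f h k n = trans (Σ<-cong (suc n) (λ i → distribˡ _ _ _)) (Σ<-+ (suc n) _ _)

  ⊛-distribʳ : ∀ f h k → (h ⊕ k) ⊛ f ≋ (h ⊛ f) ⊕ (k ⊛ f)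
  ⊛-distribʳ f h k =
    ≋-trans (⊛-comm _ _) (≋-trans (⊛-distribˡ f h k) (⊕-cong (⊛-comm f h) (⊛-comm f k)))

  scale-⊛ : ∀ a f h → scale a f ⊛ h ≋ scale a (f ⊛ h)
  scale-⊛ a f h n =
    sym (trans (*-distribˡ-Σ< (suc n) a _) (Σ<-cong (suc n) (λ i → sym (*-assoc _ _ _))))

  tail-⊛ : ∀ f h → tail (f ⊛ h) ≋ scale (f 0) (tail h) ⊕ (tail f ⊛ h)
  tail-⊛ f h n = ⊛-coeff-sucˡ f h n

  ⊛-assoc : ∀ f h k → (f ⊛ h) ⊛ k ≋ f ⊛ (h ⊛ k)
  ⊛-assoc f h k zero = begin
    ((f ⊛ h) ⊛ k) 0       ≈⟨ trans (⊛-coeff₀ (f ⊛ h) k) (*-cong (⊛-coeff₀ f h) refl) ⟩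
    f 0 * h 0 * k 0       ≈⟨ *-assoc _ _ _ ⟩
    f 0 * (h 0 * k 0)     ≈⟨ sym (trans (⊛-coeff₀ f (h ⊛ k)) (*-cong refl (⊛-coeff₀ h k))) ⟩
    (f ⊛ (h ⊛ k)) 0       ∎
  ⊛-assoc f h k (suc n) = begin
    ((f ⊛ h) ⊛ k) (suc n)
      ≈⟨ ⊛-coeff-sucˡ (f ⊛ h) k n ⟩
    (f ⊛ h) 0 * k (suc n) + (tail (f ⊛ h) ⊛ k) n
      ≈⟨ +-cong (*-cong (⊛-coeff₀ f h) refl) (⊛-cong {h = k} (tail-⊛ f h) ≋-refl n) ⟩
    f 0 * h 0 * k (suc n) + ((scale (f 0) (tail h) ⊕ (tail f ⊛ h)) ⊛ k) n
      ≈⟨ +-cong refl (⊛-distribʳ k _ _ n) ⟩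
    f 0 * h 0 * k (suc n) + ((scale (f 0) (tail h) ⊛ k) n + ((tail f ⊛ h) ⊛ k) n)
      ≈⟨ +-cong refl (+-cong (scale-⊛ (f 0) (tail h) k n) (⊛-assoc (tail f) h k n)) ⟩
    f 0 * h 0 * k (suc n) + (f 0 * (tail h ⊛ k) n + (tail f ⊛ (h ⊛ k)) n)
      ≈⟨ trans (+-cong (*-assoc _ _ _) refl) (sym (+-assoc _ _ _)) ⟩
    f 0 * (h 0 * k (suc n)) + f 0 * (tail h ⊛ k) n + (tail f ⊛ (h ⊛ k)) n
      ≈⟨ +-cong (trans (sym (distribˡ _ _ _)) (*-cong refl (sym (⊛-coeff-sucˡ h k n)))) refl ⟩
    f 0 * (h ⊛ k) (suc n) + (tail f ⊛ (h ⊛ k)) n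
      ≈⟨ ⊛-coeff-sucˡ f (h ⊛ k) n ⟨
    (f ⊛ (h ⊛ k)) (suc n) ∎

  const-⊛ : ∀ a f → const a ⊛ f ≋ scale a f
  const-⊛ a f n = trans (Σ<-head n _) (trans (+-cong refl (Σ<-zero n (λ i _ → zeroˡ _))) (+-identityʳ _))

  one-⊛ : ∀ f → one ⊛ f ≋ f
  one-⊛ f n = trans (const-⊛ 1# f n) (*-identityˡ _)

  ⊛-one : ∀ f → f ⊛ one ≋ f
  ⊛-one f = ≋-trans (⊛-comm f one) (one-⊛ f)

  seriesRing : CommutativeRing c r
  seriesRing = record
    { Carrier = Series ; _≈_ = _≋_ ; _+_ = _⊕_ ; _*_ = _⊛_ ; -_ = λ f n → - f n ; 0# = λ _ → 0# ; 1# = one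
    ; isCommutativeRing = record
      { isRing = record
        { +-isAbelianGroup = record
          { isGroup = record
            { isMonoid = record
              { isSemigroup = record
                { isMagma = record
                  { isEquivalence = record { refl = ≋-refl ; sym = ≋-sym ; trans = ≋-trans }
                  ; ∙-cong = ⊕-cong }
                ; assoc = λ f h k n → +-assoc _ _ _ }
              ; identity = (λ f n → +-identityˡ _) , (λ f n → +-identityʳ _) }
            ; inverse = (λ f n → -‿inverseˡ _) , (λ f n → -‿inverseʳ _)
            ; ⁻¹-cong = λ f≋h n → -‿cong (f≋h n) }
          ; comm = λ f h n → +-comm _ _ }
        ; *-cong = ⊛-cong
        ; *-assoc = ⊛-assoc
        ; *-identity = one-⊛ , ⊛-one
        ; distrib = ⊛-distribˡ , ⊛-distribʳ }
      ; *-comm = ⊛-comm } }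

  ⊛-congˡ : ∀ f {h h′} → h ≋ h′ → f ⊛ h ≋ f ⊛ h′
  ⊛-congˡ f {h} {h′} = ⊛-cong {f} {f} {h} {h′} ≋-refl

  ⊛-congʳ : ∀ h {f f′} → f ≋ f′ → f ⊛ h ≋ f′ ⊛ h
  ⊛-congʳ h {f} {f′} f≋f′ = ⊛-cong {f} {f′} {h} {h} f≋f′ ≋-refl

module SeriesCalculus {c r} (R : CommutativeRing c r) where
  open CommutativeRing R hiding (zero)
  open Setup R
  open FiniteSums R
  open SeriesRing R
  module S = CommutativeRing seriesRing
  open import Algebra.Solver.Ring.NaturalCoefficients.Default S.commutativeSemiring
    using (solve; _:=_; _:*_)
  open import Algebra.Properties.CommutativeSemigroup *-commutativeSemigroup using (x∙yz≈y∙xz)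
  open import Algebra.Properties.Group +-group using (∙-cancelˡ)
  open import Algebra.Properties.Ring ring using (-‿distribʳ-*)

  tpow-off : ∀ m n → m ≢ n → tpow m n ≈ 0#
  tpow-off zero    zero    m≢n = ⊥-elim (m≢n P.refl)
  tpow-off zero    (suc n) m≢n = refl
  tpow-off (suc m) zero    m≢n = refl
  tpow-off (suc m) (suc n) m≢n = tpow-off m n (m≢n ∘ P.cong suc)

  tpow-diag : ∀ m → tpow m m ≈ 1#
  tpow-diag zero    = refl
  tpow-diag (suc m) = tpow-diag m

  tpow-zero : tpow 0 ≋ one
  tpow-zero zero    = refl
  tpow-zero (suc n) = refl

  OrderAtLeast : ℕ → Series → Set r
  OrderAtLeast m w = ∀ n → n <ℕ m → w n ≈ 0#

  OrderAtLeast-cong : ∀ {m u v} → u ≋ v → OrderAtLeast m u → OrderAtLeast m v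
  OrderAtLeast-cong u≋v ord n n<m = trans (sym (u≋v n)) (ord n n<m)

  OrderAtLeast-1 : ∀ {w} → w 0 ≈ 0# → OrderAtLeast 1 w
  OrderAtLeast-1 w₀≈0 zero    _          = w₀≈0
  OrderAtLeast-1 w₀≈0 (suc n) (s≤s ())

  OrderAtLeast-weaken : ∀ {k m u} → k ≤ℕ m → OrderAtLeast m u → OrderAtLeast k u
  OrderAtLeast-weaken k≤m ord n n<k = ord n (ℕ.<-≤-trans n<k k≤m)

  tpow-order : ∀ m → OrderAtLeast m (tpow m)
  tpow-order m n n<m = tpow-off m n (λ m≡n → ℕ.<-irrefl (P.sym m≡n) n<m)

  tpow-⊛-coeff : ∀ m u n → (tpow m ⊛ u) (m +ℕ n) ≈ u n
  tpow-⊛-coeff zero    u n = trans (⊛-congʳ u tpow-zero n) (one-⊛ u n)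
  tpow-⊛-coeff (suc m) u n = trans (⊛-coeff-sucˡ (tpow (suc m)) u (m +ℕ n))
    (trans (+-cong (zeroˡ _) (tpow-⊛-coeff m u n)) (+-identityˡ _))

  tpow-⊛-order : ∀ m u → OrderAtLeast m (tpow m ⊛ u)
  tpow-⊛-order (suc m) u zero    _         = trans (⊛-coeff₀ (tpow (suc m)) u) (zeroˡ _)
  tpow-⊛-order (suc m) u (suc n) (s≤s n<m) = trans (⊛-coeff-sucˡ (tpow (suc m)) u n)
    (trans (+-cong (zeroˡ _) (tpow-⊛-order m u n n<m)) (+-identityˡ _))

  factor-tpow : ∀ m u w → OrderAtLeast m w → (∀ n → w (m +ℕ n) ≈ u n) → w ≋ tpow m ⊛ u
  factor-tpow m u w ord w≈u N with m ≤? N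
  ... | yes m≤N = P.subst (λ k → w k ≈ (tpow m ⊛ u) k) (ℕ.m+[n∸m]≡n m≤N)
                    (trans (w≈u (N ∸ m)) (sym (tpow-⊛-coeff m u (N ∸ m))))
  ... | no m≰N = trans (ord N (ℕ.≰⇒> m≰N)) (sym (tpow-⊛-order m u N (ℕ.≰⇒> m≰N)))

  tpow-+ : ∀ a b → tpow (a +ℕ b) ≋ tpow a ⊛ tpow b
  tpow-+ a b = factor-tpow a (tpow b) (tpow (a +ℕ b)) below (λ n → reflexive (shifted a n))
    where
    below : OrderAtLeast a (tpow (a +ℕ b))
    below n n<a = tpow-off (a +ℕ b) n (λ a+b≡n → ℕ.<⇒≢ (ℕ.<-≤-trans n<a (ℕ.m≤m+n a b)) (P.sym a+b≡n))
    shifted : ∀ a n → tpow (a +ℕ b) (a +ℕ n) ≡ tpow b n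
    shifted zero    n = P.refl
    shifted (suc a) n = shifted a n

  factor-shift : ∀ m w → OrderAtLeast m w → w ≋ tpow m ⊛ shift w m
  factor-shift m w ord = factor-tpow m (shift w m) w ord (λ n → reflexive (P.cong w (ℕ.+-comm m n)))

  shift-tpow-⊛ : ∀ m u → shift (tpow m ⊛ u) m ≋ u
  shift-tpow-⊛ m u n = trans (reflexive (P.cong (tpow m ⊛ u) (ℕ.+-comm n m))) (tpow-⊛-coeff m u n)

  shift-cong : ∀ {u v} m → u ≋ v → shift u m ≋ shift v m
  shift-cong m u≋v n = u≋v (n +ℕ m)

  OrderAtLeast-⊛ : ∀ a b u v → OrderAtLeast a u → OrderAtLeast b v → OrderAtLeast (a +ℕ b) (u ⊛ v)
  OrderAtLeast-⊛ a b u v ord-u ord-v =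
    OrderAtLeast-cong (S.sym factored) (tpow-⊛-order (a +ℕ b) (shift u a ⊛ shift v b))
    where
    factored : u ⊛ v ≋ tpow (a +ℕ b) ⊛ (shift u a ⊛ shift v b)
    factored = S.trans (⊛-cong (factor-shift a u ord-u) (factor-shift b v ord-v))
      (S.trans (solve 4 (λ x y z w → (x :* y) :* (z :* w) := (x :* z) :* (y :* w)) S.refl
                  (tpow a) (shift u a) (tpow b) (shift v b))
        (⊛-congʳ (shift u a ⊛ shift v b) (S.sym (tpow-+ a b))))

  tpow-⊛-cancel : ∀ m u v → tpow m ⊛ u ≋ tpow m ⊛ v → u ≋ v
  tpow-⊛-cancel m u v tu≈tv n = trans (sym (tpow-⊛-coeff m u n)) (trans (tu≈tv (m +ℕ n)) (tpow-⊛-coeff m v n))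

  -- [tⁿ](g ⊛ u) is g₀ uₙ plus terms involving only u₀, …, uₙ₋₁.
  unit-⊛-cancel : ∀ g y u v → g 0 * y ≈ 1# → g ⊛ u ≋ g ⊛ v → u ≋ v
  unit-⊛-cancel g y u v g₀y≈1 gu≈gv = <-rec _ step
    where
    step : ∀ n → (∀ {i} → i <ℕ n → u i ≈ v i) → u n ≈ v n
    step n ih = begin
      u n                  ≈⟨ sym (*-identityʳ _) ⟩
      u n * 1#             ≈⟨ *-cong refl (sym g₀y≈1) ⟩
      u n * (g 0 * y)      ≈⟨ sym (*-assoc _ _ _) ⟩
      u n * g 0 * y        ≈⟨ *-cong top refl ⟩
      v n * g 0 * y        ≈⟨ *-assoc _ _ _ ⟩
      v n * (g 0 * y)      ≈⟨ *-cong refl g₀y≈1 ⟩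
      v n * 1#             ≈⟨ *-identityʳ _ ⟩
      v n                  ∎
      where
      open import Relation.Binary.Reasoning.Setoid setoid
      g₀ : g (n ∸ n) ≈ g 0
      g₀ = reflexive (P.cong g (ℕ.n∸n≡0 n))
      top : u n * g 0 ≈ v n * g 0
      top = ∙-cancelˡ (Σ< n (λ i → u i * g (n ∸ i))) _ _ (begin
        Σ< n (λ i → u i * g (n ∸ i)) + u n * g 0   ≈⟨ +-cong refl (*-cong refl (sym g₀)) ⟩
        (u ⊛ g) n                                   ≈⟨ ⊛-comm u g n ⟩
        (g ⊛ u) n                                   ≈⟨ gu≈gv n ⟩
        (g ⊛ v) n                                   ≈⟨ ⊛-comm g v n ⟩
        (v ⊛ g) n
          ≈⟨ +-cong (Σ<-congᵢ n (λ i i<n → *-cong (sym (ih i<n)) refl)) (*-cong refl g₀) ⟩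
        Σ< n (λ i → u i * g (n ∸ i)) + v n * g 0   ∎)

  pow-⊛ : ∀ f h k → pow (f ⊛ h) k ≋ pow f k ⊛ pow h k
  pow-⊛ f h zero    = S.sym (one-⊛ one)
  pow-⊛ f h (suc k) = S.trans (⊛-congˡ (f ⊛ h) (pow-⊛ f h k))
    (solve 4 (λ a b c d → (a :* b) :* (c :* d) := (a :* c) :* (b :* d)) S.refl f h (pow f k) (pow h k))

  pow-one : ∀ k → pow one k ≋ one
  pow-one zero    = ≋-refl
  pow-one (suc k) = S.trans (one-⊛ (pow one k)) (pow-one k)

  OrderAtLeast-pow : ∀ m f k → OrderAtLeast m f → OrderAtLeast (k *ℕ m) (pow f k)
  OrderAtLeast-pow m f zero    ord n ()
  OrderAtLeast-pow m f (suc k) ord = OrderAtLeast-⊛ m (k *ℕ m) f (pow f k) ord (OrderAtLeast-pow m f k ord)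

  ΠS-congᵢ : ∀ n {h h′} → (∀ i → i <ℕ n → h i ≋ h′ i) → ΠS n h ≋ ΠS n h′
  ΠS-congᵢ zero    h≋h′ = ≋-refl
  ΠS-congᵢ (suc n) h≋h′ = ⊛-cong (ΠS-congᵢ n (λ i i<n → h≋h′ i (ℕ.m<n⇒m<1+n i<n))) (h≋h′ n (ℕ.n<1+n n))

  ΠS-⊛ : ∀ n h h′ → ΠS n (λ i → h i ⊛ h′ i) ≋ ΠS n h ⊛ ΠS n h′
  ΠS-⊛ zero    h h′ = S.sym (one-⊛ one)
  ΠS-⊛ (suc n) h h′ = S.trans (⊛-congʳ (h n ⊛ h′ n) (ΠS-⊛ n h h′))
    (solve 4 (λ a b c d → (a :* b) :* (c :* d) := (a :* c) :* (b :* d)) S.refl (ΠS n h) (ΠS n h′) (h n) (h′ n))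

  ΠS-pow : ∀ n h k → ΠS n (λ i → pow (h i) k) ≋ pow (ΠS n h) k
  ΠS-pow zero    h k = S.sym (pow-one k)
  ΠS-pow (suc n) h k = S.trans (⊛-congʳ (pow (h n) k) (ΠS-pow n h k)) (S.sym (pow-⊛ (ΠS n h) (h n) k))

  ΠS-trailing-ones : ∀ {m n} h → m ≤ℕ n → (∀ i → m ≤ℕ i → i <ℕ n → h i ≋ one) → ΠS n h ≋ ΠS m h
  ΠS-trailing-ones {m} {n} h m≤n h≋1 with ℕ.m≤n⇒m<n∨m≡n m≤n
  ... | inj₂ P.refl = ≋-refl
  ΠS-trailing-ones {m} {suc n} h m≤n h≋1 | inj₁ (s≤s m≤n′) =
    S.trans (⊛-cong (ΠS-trailing-ones h m≤n′ (λ i m≤i i<n → h≋1 i m≤i (ℕ.m<n⇒m<1+n i<n)))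
                    (h≋1 n m≤n′ (ℕ.n<1+n n)))
      (⊛-one _)

  ΠS-coeff₀ : ∀ n h → ΠS n h 0 ≈ Π< n (λ i → h i 0)
  ΠS-coeff₀ zero    h = refl
  ΠS-coeff₀ (suc n) h = trans (⊛-coeff₀ (ΠS n h) (h n)) (*-cong (ΠS-coeff₀ n h) refl)

  ΠS-tpow-⊛ : ∀ n h → ΠS n (λ i → tpow 1 ⊛ h i) ≋ tpow n ⊛ ΠS n h
  ΠS-tpow-⊛ zero    h = S.sym (S.trans (⊛-congʳ one tpow-zero) (one-⊛ one))
  ΠS-tpow-⊛ (suc n) h = S.trans (⊛-congʳ (tpow 1 ⊛ h n) (ΠS-tpow-⊛ n h))
    (S.trans (solve 4 (λ a b c d → (a :* b) :* (c :* d) := (c :* a) :* (b :* d)) S.refl (tpow n) (ΠS n h) (tpow 1) (h n))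
      (⊛-congʳ (ΠS n h ⊛ h n) (S.sym (tpow-+ 1 n))))

  const-cong : ∀ {a a′} → a ≈ a′ → const a ≋ const a′
  const-cong a≈a′ zero    = a≈a′
  const-cong a≈a′ (suc n) = refl

  ⊖-intro : ∀ {f h k} → f ≋ k ⊕ h → f ⊖ h ≋ k
  ⊖-intro f≋k+h n = trans (+-cong (f≋k+h n) refl)
    (trans (+-assoc _ _ _) (trans (+-cong refl (-‿inverseʳ _)) (+-identityʳ _)))

  ⊖-elim : ∀ {f h k} → f ⊖ h ≋ k → f ≋ k ⊕ h
  ⊖-elim f-h≋k n = trans (sym (+-identityʳ _))
    (trans (+-cong refl (sym (-‿inverseˡ _))) (trans (sym (+-assoc _ _ _)) (+-cong (f-h≋k n) refl)))

  ⊖-cong : ∀ {f f′ h h′} → f ≋ f′ → h ≋ h′ → f ⊖ h ≋ f′ ⊖ h′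
  ⊖-cong f≋f′ h≋h′ n = +-cong (f≋f′ n) (-‿cong (h≋h′ n))

  ⊛-⊖ : ∀ f h k → f ⊛ (h ⊖ k) ≋ (f ⊛ h) ⊖ (f ⊛ k)
  ⊛-⊖ f h k n = trans (Σ<-cong (suc n) (λ i → trans (distribˡ _ _ _) (+-cong refl (sym (-‿distribʳ-* _ _)))))
    (trans (Σ<-+ (suc n) _ _) (+-cong refl (sym (-‿distrib-Σ< (suc n) _))))

  pow-coeff-below : ∀ X → X 0 ≈ 0# → ∀ {k n} → n <ℕ k → pow X k n ≈ 0#
  pow-coeff-below X X₀≈0 {k} {n} n<k =
    OrderAtLeast-pow 1 X k (OrderAtLeast-1 X₀≈0) n (P.subst (n <ℕ_) (P.sym (ℕ.*-identityʳ k)) n<k)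

  comp-truncate : ∀ α X → X 0 ≈ 0# → ∀ {n N} → n ≤ℕ N → Σ< (suc N) (λ k → α k * pow X k n) ≈ comp α X n
  comp-truncate α X X₀≈0 n≤N =
    Σ<-truncate _ (s≤s n≤N) (λ k n<k → trans (*-cong refl (pow-coeff-below X X₀≈0 n<k)) (zeroʳ _))

  ⊛-comp : ∀ u α X → X 0 ≈ 0# → ∀ n → (u ⊛ comp α X) n ≈ Σ< (suc n) (λ j → α j * (u ⊛ pow X j) n)
  ⊛-comp u α X X₀≈0 n = begin
    Σ< (suc n) (λ i → u i * comp α X (n ∸ i))
      ≈⟨ Σ<-cong (suc n) (λ i → *-cong refl (sym (comp-truncate α X X₀≈0 (ℕ.m∸n≤m n i)))) ⟩
    Σ< (suc n) (λ i → u i * Σ< (suc n) (λ k → α k * pow X k (n ∸ i)))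
      ≈⟨ Σ<-cong (suc n) (λ i → *-distribˡ-Σ< (suc n) (u i) _) ⟩
    Σ< (suc n) (λ i → Σ< (suc n) (λ k → u i * (α k * pow X k (n ∸ i))))
      ≈⟨ Σ<-comm (suc n) (suc n) _ ⟩
    Σ< (suc n) (λ k → Σ< (suc n) (λ i → u i * (α k * pow X k (n ∸ i))))
      ≈⟨ Σ<-cong (suc n) (λ k → Σ<-cong (suc n) (λ i → x∙yz≈y∙xz _ _ _)) ⟩
    Σ< (suc n) (λ k → Σ< (suc n) (λ i → α k * (u i * pow X k (n ∸ i))))
      ≈⟨ Σ<-cong (suc n) (λ k → sym (*-distribˡ-Σ< (suc n) (α k) _)) ⟩
    Σ< (suc n) (λ j → α j * (u ⊛ pow X j) n) ∎
    where open import Relation.Binary.Reasoning.Setoid setoid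

  comp-head : ∀ α X → X 0 ≈ 0# → comp α X ⊖ const (α 0) ≋ X ⊛ comp (tail α) X
  comp-head α X X₀≈0 = ⊖-intro λ n → begin
    comp α X n
      ≈⟨ Σ<-head n _ ⟩
    α 0 * one n + Σ< n (λ k → α (suc k) * (X ⊛ pow X k) n)
      ≈⟨ +-cong (constant-term n) (sym (Σ<-truncate _ (ℕ.n≤1+n n)
           (λ k n≤k → trans (*-cong refl (pow-coeff-below X X₀≈0 (s≤s n≤k))) (zeroʳ _)))) ⟩
    const (α 0) n + Σ< (suc n) (λ k → α (suc k) * (X ⊛ pow X k) n)
      ≈⟨ +-cong refl (sym (⊛-comp X (tail α) X X₀≈0 n)) ⟩
    const (α 0) n + (X ⊛ comp (tail α) X) n
      ≈⟨ +-comm _ _ ⟩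
    (X ⊛ comp (tail α) X) n + const (α 0) n ∎
    where
    open import Relation.Binary.Reasoning.Setoid setoid
    constant-term : ∀ n → α 0 * one n ≈ const (α 0) n
    constant-term zero    = *-identityʳ _
    constant-term (suc n) = zeroʳ _

module Dilation {c r} (R : CommutativeRing c r) (L : ℕ) where
  open CommutativeRing R hiding (zero)
  open Setup R
  open FiniteSums R
  open SeriesRing R
  open SeriesCalculus R

  ℓ : ℕ
  ℓ = suc L

  record Dilated (u û : Series) : Set r where
    constructor dilated
    field
      coeff-multiple : ∀ n → u (ℓ *ℕ n) ≈ û n
      coeff-other    : ∀ N → ¬ (ℓ ∣ N) → u N ≈ 0#
  open Dilated public

  Dilated-cong : ∀ {u u′ û û′} → u ≋ u′ → û ≋ û′ → Dilated u û → Dilated u′ û′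
  Dilated-cong u≋u′ û≋û′ (dilated mul oth) =
    dilated (λ n → trans (sym (u≋u′ _)) (trans (mul n) (û≋û′ n)))
            (λ N ℓ∤N → trans (sym (u≋u′ N)) (oth N ℓ∤N))

  Dilated-unique : ∀ {u û v̂} → Dilated u û → Dilated u v̂ → û ≋ v̂
  Dilated-unique du dv n = trans (sym (coeff-multiple du n)) (coeff-multiple dv n)

  Dilated-⊕ : ∀ {u û v v̂} → Dilated u û → Dilated v v̂ → Dilated (u ⊕ v) (û ⊕ v̂)
  Dilated-⊕ du dv = dilated (λ n → +-cong (coeff-multiple du n) (coeff-multiple dv n))
    (λ N ℓ∤N → trans (+-cong (coeff-other du N ℓ∤N) (coeff-other dv N ℓ∤N)) (+-identityˡ _))

  Dilated-⊖ : ∀ {u û v v̂} → Dilated u û → Dilated v v̂ → Dilated (u ⊖ v) (û ⊖ v̂)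
  Dilated-⊖ du dv = dilated (λ n → +-cong (coeff-multiple du n) (-‿cong (coeff-multiple dv n)))
    (λ N ℓ∤N → trans (+-cong (coeff-other du N ℓ∤N) (-‿cong (coeff-other dv N ℓ∤N))) (-‿inverseʳ 0#))

  Dilated-const : ∀ a → Dilated (const a) (const a)
  Dilated-const a = dilated mul oth
    where
    mul : ∀ n → const a (ℓ *ℕ n) ≈ const a n
    mul zero    = reflexive (P.cong (const a) (ℕ.*-zeroʳ ℓ))
    mul (suc n) = refl
    oth : ∀ N → ¬ (ℓ ∣ N) → const a N ≈ 0#
    oth zero    ℓ∤0 = ⊥-elim (ℓ∤0 (P.subst (ℓ ∣_) (ℕ.*-zeroʳ ℓ) (m∣m*n 0)))
    oth (suc N) ℓ∤N = refl

  Dilated-order : ∀ {w ŵ} → Dilated w ŵ → w 0 ≈ 0# → OrderAtLeast ℓ w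
  Dilated-order dw w₀≈0 zero    _   = w₀≈0
  Dilated-order dw w₀≈0 (suc n) n<ℓ = coeff-other dw (suc n) (λ ℓ∣ → ℕ.<⇒≱ n<ℓ (∣⇒≤ ℓ∣))

  Σ<-multiples : ∀ n h → (∀ i → ¬ (ℓ ∣ i) → h i ≈ 0#) → Σ< (suc (ℓ *ℕ n)) h ≈ Σ< (suc n) (λ i → h (ℓ *ℕ i))
  Σ<-multiples zero    h h≈0 rewrite ℕ.*-zeroʳ ℓ = refl
  Σ<-multiples (suc n) h h≈0 = begin
    Σ< (suc (ℓ *ℕ suc n)) h
      ≈⟨ reflexive (P.cong (λ k → Σ< (suc k) h) ℓ[1+n]) ⟩
    Σ< (suc (ℓ *ℕ n) +ℕ ℓ) h
      ≈⟨ Σ<-split (suc (ℓ *ℕ n)) ℓ h ⟩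
    Σ< (suc (ℓ *ℕ n)) h + (Σ< L (λ i → h (suc (ℓ *ℕ n) +ℕ i)) + h (suc (ℓ *ℕ n) +ℕ L))
      ≈⟨ +-cong (Σ<-multiples n h h≈0) (+-cong (Σ<-zero L between) (reflexive (P.cong h last))) ⟩
    Σ< (suc n) (λ i → h (ℓ *ℕ i)) + (0# + h (ℓ *ℕ suc n))
      ≈⟨ +-cong refl (+-identityˡ _) ⟩
    Σ< (suc (suc n)) (λ i → h (ℓ *ℕ i)) ∎
    where
    open import Relation.Binary.Reasoning.Setoid setoid
    ℓ[1+n] : ℓ *ℕ suc n ≡ ℓ *ℕ n +ℕ ℓ
    ℓ[1+n] = P.trans (ℕ.*-suc ℓ n) (ℕ.+-comm ℓ (ℓ *ℕ n))
    last : suc (ℓ *ℕ n) +ℕ L ≡ ℓ *ℕ suc n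
    last = P.trans (P.sym (ℕ.+-suc (ℓ *ℕ n) L)) (P.sym ℓ[1+n])
    between : ∀ i → i <ℕ L → h (suc (ℓ *ℕ n) +ℕ i) ≈ 0#
    between i i<L = h≈0 _ λ ℓ∣ →
      ℕ.<⇒≱ (s≤s i<L) (∣⇒≤ (∣m+n∣m⇒∣n (P.subst (ℓ ∣_) (P.sym (ℕ.+-suc (ℓ *ℕ n) i)) ℓ∣) (m∣m*n n)))

  Dilated-⊛ : ∀ {u û v v̂} → Dilated u û → Dilated v v̂ → Dilated (u ⊛ v) (û ⊛ v̂)
  Dilated-⊛ {u} {û} {v} {v̂} du dv = dilated mul oth
    where
    mul : ∀ n → (u ⊛ v) (ℓ *ℕ n) ≈ (û ⊛ v̂) n
    mul n = trans (Σ<-multiples n (λ i → u i * v (ℓ *ℕ n ∸ i))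
                                  (λ i ℓ∤i → trans (*-cong (coeff-other du i ℓ∤i) refl) (zeroˡ _)))
      (Σ<-cong (suc n) (λ i → *-cong (coeff-multiple du i)
        (trans (reflexive (P.cong v (P.sym (ℕ.*-distribˡ-∸ ℓ n i)))) (coeff-multiple dv (n ∸ i)))))
    -- in each term u i v (N - i), either ℓ ∤ i or ℓ ∤ N - i
    oth : ∀ N → ¬ (ℓ ∣ N) → (u ⊛ v) N ≈ 0#
    oth N ℓ∤N = Σ<-zero (suc N) term
      where
      term : ∀ i → i <ℕ suc N → u i * v (N ∸ i) ≈ 0#
      term i i≤N with ℓ ∣? i
      ... | no ℓ∤i  = trans (*-cong (coeff-other du i ℓ∤i) refl) (zeroˡ _)
      ... | yes ℓ∣i =
        trans (*-cong refl (coeff-other dv (N ∸ i) (λ ℓ∣ → ℓ∤N (∣m∸n∣n⇒∣m ℓ (ℕ.≤-pred i≤N) ℓ∣ ℓ∣i)))) (zeroʳ _)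

  Dilated-pow : ∀ {u û} k → Dilated u û → Dilated (pow u k) (pow û k)
  Dilated-pow zero    du = Dilated-const 1#
  Dilated-pow (suc k) du = Dilated-⊛ du (Dilated-pow k du)

  Dilated-ΠS : ∀ n {h ĥ} → (∀ i → i <ℕ n → Dilated (h i) (ĥ i)) → Dilated (ΠS n h) (ΠS n ĥ)
  Dilated-ΠS zero    dh = Dilated-const 1#
  Dilated-ΠS (suc n) dh = Dilated-⊛ (Dilated-ΠS n (λ i i<n → dh i (ℕ.m<n⇒m<1+n i<n))) (dh n (ℕ.n<1+n n))

  Dilated-tpow : ∀ m → Dilated (tpow (ℓ *ℕ m)) (tpow m)
  Dilated-tpow m = dilated mul oth
    where
    mul : ∀ n → tpow (ℓ *ℕ m) (ℓ *ℕ n) ≈ tpow m n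
    mul n with m ≟ n
    ... | yes P.refl = trans (tpow-diag (ℓ *ℕ m)) (sym (tpow-diag m))
    ... | no m≢n     = trans (tpow-off _ _ (m≢n ∘ ℕ.*-cancelˡ-≡ m n ℓ)) (sym (tpow-off m n m≢n))
    oth : ∀ N → ¬ (ℓ ∣ N) → tpow (ℓ *ℕ m) N ≈ 0#
    oth N ℓ∤N = tpow-off _ N (λ ℓm≡N → ℓ∤N (P.subst (ℓ ∣_) ℓm≡N (m∣m*n m)))

  Dilated-comp : ∀ {F X} α → Dilated F X → F 0 ≈ 0# → Dilated (comp α F) (comp α X)
  Dilated-comp {F} {X} α dF F₀≈0 = dilated mul oth
    where
    X₀≈0 : X 0 ≈ 0#
    X₀≈0 = trans (sym (coeff-multiple dF 0)) (trans (reflexive (P.cong F (ℕ.*-zeroʳ ℓ))) F₀≈0)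
    mul : ∀ n → comp α F (ℓ *ℕ n) ≈ comp α X n
    mul n = trans (Σ<-cong (suc (ℓ *ℕ n)) (λ k → *-cong refl (coeff-multiple (Dilated-pow k dF) n)))
      (comp-truncate α X X₀≈0 (ℕ.m≤n*m n ℓ))
    oth : ∀ N → ¬ (ℓ ∣ N) → comp α F N ≈ 0#
    oth N ℓ∤N = Σ<-zero (suc N) (λ k _ → trans (*-cong refl (coeff-other (Dilated-pow k dF) N ℓ∤N)) (zeroʳ _))

-- `exponent` unfolds to `Array.e` for ℓ = suc L.
module ColumnExponent (L : ℕ) where
  open +-*-Solver

  ℓ : ℕ
  ℓ = suc L

  exponent : ℕ → ℕ → ℕ
  exponent i k = ((k +ℕ ℓ) ∸ (2 +ℕ i)) / ℓ

  exponent-exact : ∀ i k a q → a <ℕ ℓ → k +ℕ ℓ ≡ (2 +ℕ i) +ℕ (a +ℕ q *ℕ ℓ) → exponent i k ≡ q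
  exponent-exact i k a q a<ℓ k+ℓ≡ = begin
    (k +ℕ ℓ ∸ (2 +ℕ i)) / ℓ                      ≡⟨ P.cong (λ x → (x ∸ (2 +ℕ i)) / ℓ) k+ℓ≡ ⟩
    ((2 +ℕ i) +ℕ (a +ℕ q *ℕ ℓ) ∸ (2 +ℕ i)) / ℓ   ≡⟨ P.cong (_/ ℓ) (ℕ.m+n∸m≡n (2 +ℕ i) _) ⟩
    (a +ℕ q *ℕ ℓ) / ℓ                            ≡⟨ +-distrib-/-∣ʳ a (n∣m*n q) ⟩
    a / ℓ +ℕ q *ℕ ℓ / ℓ                          ≡⟨ P.cong₂ _+ℕ_ (m<n⇒m/n≡0 a<ℓ) (m*n/n≡m q ℓ) ⟩
    q                                            ∎
    where open P.≡-Reasoning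

  exponent-early : ∀ {i r} j → i <ℕ r → r ≤ℕ L → exponent i (suc (r +ℕ ℓ *ℕ j)) ≡ suc j
  exponent-early {i} {r} j i<r r≤L =
    exponent-exact i (suc (r +ℕ ℓ *ℕ j)) a (suc j) (s≤s (ℕ.≤-trans (ℕ.m∸n≤m r (suc i)) r≤L))
      (P.subst (λ r′ → suc (r′ +ℕ ℓ *ℕ j) +ℕ ℓ ≡ (2 +ℕ i) +ℕ (a +ℕ suc j *ℕ ℓ)) (ℕ.m+[n∸m]≡n i<r)
        (solve 4 (λ i a j l → (con 1 :+ ((con 1 :+ i) :+ a) :+ l :* j) :+ l := (con 2 :+ i) :+ (a :+ (con 1 :+ j) :* l))
          P.refl i a j ℓ))
    where
    a : ℕ
    a = r ∸ suc i

  exponent-late : ∀ {i r} j → r ≤ℕ i → i ≤ℕ L → exponent i (suc (r +ℕ ℓ *ℕ j)) ≡ j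
  exponent-late {i} {r} j r≤i i≤L = exponent-exact i (suc (r +ℕ ℓ *ℕ j)) (r +ℕ y) j (s≤s r+y≤L)
    (P.trans (P.cong (λ x → suc (r +ℕ ℓ *ℕ j) +ℕ suc x) (P.sym (ℕ.m+[n∸m]≡n i≤L)))
      (solve 5 (λ r i y j l → (con 1 :+ r :+ l :* j) :+ (con 1 :+ (i :+ y)) := (con 2 :+ i) :+ ((r :+ y) :+ j :* l))
        P.refl r i y j ℓ))
    where
    y : ℕ
    y = L ∸ i
    r+y≤L : r +ℕ y ≤ℕ L
    r+y≤L = P.subst (r +ℕ y ≤ℕ_) (ℕ.m+[n∸m]≡n i≤L) (ℕ.+-monoˡ-≤ y r≤i)

-- An equation (ℓ - 1) k + N = ℓ n says that d̂_{n,k} = d_{N,k}.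
module CompressionIndex (L : ℕ) where
  open +-*-Solver

  ℓ : ℕ
  ℓ = suc L

  row-high : ∀ a p → L *ℕ (a +ℕ ℓ) +ℕ ((a +ℕ ℓ *ℕ p) +ℕ ℓ) ≡ ℓ *ℕ (a +ℕ ℓ +ℕ p)
  row-high a p = solve 3 (λ L a p → L :* (a :+ (con 1 :+ L)) :+ ((a :+ (con 1 :+ L) :* p) :+ (con 1 :+ L))
                                    := (con 1 :+ L) :* (a :+ (con 1 :+ L) :+ p)) P.refl L a p

  row-low : ∀ m p → L *ℕ m +ℕ ((m +ℕ ℓ *ℕ p) +ℕ ℓ) ≡ ℓ *ℕ (suc m +ℕ p)
  row-low m p = solve 3 (λ L m p → L :* m :+ ((m :+ (con 1 :+ L) :* p) :+ (con 1 :+ L))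
                                   := (con 1 :+ L) :* ((con 1 :+ m) :+ p)) P.refl L m p

  row-entry : ∀ m p j → L *ℕ (m +ℕ ℓ *ℕ j) +ℕ (m +ℕ ℓ *ℕ p) ≡ ℓ *ℕ ((m +ℕ p) +ℕ j *ℕ L)
  row-entry m p j = solve 4 (λ L m p j → L :* (m :+ (con 1 :+ L) :* j) :+ (m :+ (con 1 :+ L) :* p)
                                         := (con 1 :+ L) :* ((m :+ p) :+ j :* L)) P.refl L m p j

  row-high-lower : ∀ a p → a +ℕ ℓ +ℕ p ∸ ℓ ≡ a +ℕ p
  row-high-lower a p = P.trans (P.cong (_∸ ℓ) (solve 3 (λ a l p → a :+ l :+ p := (a :+ p) :+ l) P.refl a ℓ p))
                               (ℕ.m+n∸n≡m (a +ℕ p) ℓ)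

module MultipleAlmostRiordan {c c′} (R : CommutativeRing c c′) where
  open CommutativeRing R hiding (zero)
  open Setup R

  module Properties (L : ℕ) (b g : Series) (fs : ℕ → Series)
    (b-sparse : ∀ n → ¬ (n % suc L ≡ 0) → b n ≈ 0#)
    (g-sparse : ∀ n → ¬ (n % suc L ≡ 0) → g n ≈ 0#)
    (fs-sparse : ∀ j → j <ℕ suc L → ∀ n → ¬ (n % suc L ≡ 1) → fs j n ≈ 0#)
    where
    open FiniteSums R
    open SeriesRing R
    open SeriesCalculus R
    open Dilation R L
    open Array ℓ b g fs
    open import Algebra.Solver.Ring.NaturalCoefficients.Default S.commutativeSemiring
      using (solve; _:=_; _:*_; _:+_)
    open import Algebra.Properties.Ring ring using (-0#≈0#)

    b-dilated : Dilated b bhat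
    b-dilated = dilated (λ n → refl) (λ N ℓ∤N → b-sparse N (ℓ∤N ∘ m%n≡0⇒n∣m N ℓ))

    g-dilated : Dilated g ghat
    g-dilated = dilated (λ n → refl) (λ N ℓ∤N → g-sparse N (ℓ∤N ∘ m%n≡0⇒n∣m N ℓ))

    φ ψ : ℕ → Series
    φ j = tail (fs j)
    ψ j = tail (fhat j)

    φ-dilated : ∀ j → j <ℕ ℓ → Dilated (φ j) (ψ j)
    φ-dilated j j<ℓ = dilated (λ n → reflexive (P.cong (fs j) (ℕ.+-comm 1 (ℓ *ℕ n)))) oth
      where
      oth : ∀ N → ¬ (ℓ ∣ N) → φ j N ≈ 0#
      oth N ℓ∤N = fs-sparse j j<ℓ (suc N) λ 1+N%ℓ≡1 → ℓ∤N (divides (suc N / ℓ)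
        (ℕ.suc-injective (P.trans (m≡m%n+[m/n]*n (suc N) ℓ) (P.cong (_+ℕ (suc N / ℓ) *ℕ ℓ) 1+N%ℓ≡1))))

    fs-factor : ∀ j → j <ℕ ℓ → fs j ≋ tpow 1 ⊛ φ j
    fs-factor j j<ℓ = factor-tpow 1 (φ j) (fs j) (OrderAtLeast-1 (fs-sparse j j<ℓ 0 (λ ()))) (λ n → refl)

    fhat-factor : ∀ j → fhat j ≋ tpow 1 ⊛ ψ j
    fhat-factor j = factor-tpow 1 (ψ j) (fhat j) (OrderAtLeast-1 refl) (λ n → refl)

    prefix Φ Ψ : ℕ → Series
    prefix r = ΠS r fs
    Φ r = ΠS r φ
    Ψ r = ΠS r ψ

    F : Series
    F = prefix ℓ

    Φ-dilated : ∀ r → r ≤ℕ ℓ → Dilated (Φ r) (Ψ r)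
    Φ-dilated r r≤ℓ = Dilated-ΠS r (λ i i<r → φ-dilated i (ℕ.<-≤-trans i<r r≤ℓ))

    prefix-factor : ∀ r → r ≤ℕ ℓ → prefix r ≋ tpow r ⊛ Φ r
    prefix-factor r r≤ℓ = S.trans (ΠS-congᵢ r (λ i i<r → fs-factor i (ℕ.<-≤-trans i<r r≤ℓ))) (ΠS-tpow-⊛ r φ)

    fhat-prefix-factor : ∀ r → ΠS r fhat ≋ tpow r ⊛ Ψ r
    fhat-prefix-factor r = S.trans (ΠS-congᵢ r (λ i _ → fhat-factor i)) (ΠS-tpow-⊛ r ψ)

    F-order : OrderAtLeast ℓ F
    F-order = OrderAtLeast-cong (S.sym (prefix-factor ℓ ℕ.≤-refl)) (tpow-⊛-order ℓ (Φ ℓ))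

    F₀≈0 : F 0 ≈ 0#
    F₀≈0 = F-order 0 (s≤s z≤n)

    tpow-ℓ : tpow ℓ ≋ tpow L ⊛ tpow 1
    tpow-ℓ = S.trans (S.reflexive (P.cong tpow (ℕ.+-comm 1 L))) (tpow-+ L 1)

    tpow-ℓ-dilated : Dilated (tpow ℓ) (tpow 1)
    tpow-ℓ-dilated = Dilated-cong (S.reflexive (P.cong tpow (ℕ.*-identityʳ ℓ))) S.refl (Dilated-tpow 1)

    X-factor : X ≋ tpow 1 ⊛ Ψ ℓ
    X-factor n = begin
      Fhat (n +ℕ L)                        ≈⟨ fhat-prefix-factor ℓ (n +ℕ L) ⟩
      (tpow ℓ ⊛ Ψ ℓ) (n +ℕ L)              ≈⟨ ⊛-congʳ (Ψ ℓ) tpow-ℓ (n +ℕ L) ⟩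
      ((tpow L ⊛ tpow 1) ⊛ Ψ ℓ) (n +ℕ L)   ≈⟨ ⊛-assoc (tpow L) (tpow 1) (Ψ ℓ) (n +ℕ L) ⟩
      (tpow L ⊛ (tpow 1 ⊛ Ψ ℓ)) (n +ℕ L)   ≈⟨ shift-tpow-⊛ L (tpow 1 ⊛ Ψ ℓ) n ⟩
      (tpow 1 ⊛ Ψ ℓ) n                     ∎
      where open import Relation.Binary.Reasoning.Setoid setoid

    -- F = t^ℓ Φ ℓ and X = t Ψ ℓ
    F-dilated : Dilated F X
    F-dilated = Dilated-cong (S.sym (prefix-factor ℓ ℕ.≤-refl)) (S.sym X-factor)
      (Dilated-⊛ tpow-ℓ-dilated (Φ-dilated ℓ ℕ.≤-refl))


    open ColumnExponent L using (exponent-early; exponent-late)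

    -- the factors f_{i+1} (i < r) that column r + 1 + ℓ j carries beyond F^j
    prefixFactor : ℕ → ℕ → Series
    prefixFactor r i with i <? r
    ... | yes _ = fs i
    ... | no  _ = one

    column-factor-pow : ∀ r j i → r ≤ℕ L → i <ℕ ℓ →
      pow (fs i) (e i (suc (r +ℕ ℓ *ℕ j))) ≋ pow (fs i) j ⊛ prefixFactor r i
    column-factor-pow r j i r≤L i<ℓ with i <? r
    ... | yes i<r = S.trans (S.reflexive (P.cong (pow (fs i)) (exponent-early j i<r r≤L))) (⊛-comm (fs i) (pow (fs i) j))
    ... | no  i≮r = S.trans (S.reflexive (P.cong (pow (fs i)) (exponent-late j (ℕ.≮⇒≥ i≮r) (ℕ.≤-pred i<ℓ))))
                            (S.sym (⊛-one _))

    ΠS-prefixFactor : ∀ r → r ≤ℕ ℓ → ΠS ℓ (prefixFactor r) ≋ prefix r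
    ΠS-prefixFactor r r≤ℓ = S.trans (ΠS-trailing-ones (prefixFactor r) r≤ℓ later) (ΠS-congᵢ r earlier)
      where
      later : ∀ i → r ≤ℕ i → i <ℕ ℓ → prefixFactor r i ≋ one
      later i r≤i _ with i <? r
      ... | yes i<r = ⊥-elim (ℕ.<⇒≱ i<r r≤i)
      ... | no  _   = S.refl
      earlier : ∀ i → i <ℕ r → prefixFactor r i ≋ fs i
      earlier i i<r with i <? r
      ... | yes _   = S.refl
      ... | no  i≮r = ⊥-elim (i≮r i<r)

    baseColumn : ℕ → Series
    baseColumn r = (tpow 1 ⊛ g) ⊛ prefix r

    column-factor : ∀ r j → r ≤ℕ L → column (suc (r +ℕ ℓ *ℕ j)) ≋ baseColumn r ⊛ pow F j
    column-factor r j r≤L = S.trans (⊛-congˡ (tpow 1 ⊛ g) product)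
      (solve 3 (λ a x y → a :* (x :* y) := (a :* y) :* x) S.refl (tpow 1 ⊛ g) (pow F j) (prefix r))
      where
      product : ΠS ℓ (λ i → pow (fs i) (e i (suc (r +ℕ ℓ *ℕ j)))) ≋ pow F j ⊛ prefix r
      product = S.trans (ΠS-congᵢ ℓ (λ i i<ℓ → column-factor-pow r j i r≤L i<ℓ))
        (S.trans (ΠS-⊛ ℓ (λ i → pow (fs i) j) (prefixFactor r))
          (⊛-cong (ΠS-pow ℓ fs j) (ΠS-prefixFactor r (ℕ.m≤n⇒m≤1+n r≤L))))

    column-base : ∀ r → r ≤ℕ L → column (suc r) ≋ baseColumn r
    column-base r r≤L = S.trans (S.reflexive (P.cong (λ k → column (suc k)) (P.sym r+ℓ0≡r)))
      (S.trans (column-factor r 0 r≤L) (⊛-one (baseColumn r)))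
      where
      r+ℓ0≡r : r +ℕ ℓ *ℕ 0 ≡ r
      r+ℓ0≡r = P.trans (P.cong (r +ℕ_) (ℕ.*-zeroʳ ℓ)) (ℕ.+-identityʳ r)

    G Ĝ : ℕ → Series
    G r = g ⊛ Φ r
    Ĝ r = ghat ⊛ Ψ r

    G-dilated : ∀ r → r ≤ℕ ℓ → Dilated (G r) (Ĝ r)
    G-dilated r r≤ℓ = Dilated-⊛ g-dilated (Φ-dilated r r≤ℓ)

    G-coeff₀ : ∀ r → G r 0 ≈ g 0 * Π< r c'
    G-coeff₀ r = trans (⊛-coeff₀ g (Φ r)) (*-cong refl (ΠS-coeff₀ r φ))

    baseColumn-factor : ∀ r → r ≤ℕ ℓ → baseColumn r ≋ tpow (suc r) ⊛ G r
    baseColumn-factor r r≤ℓ = S.trans (⊛-congˡ (tpow 1 ⊛ g) (prefix-factor r r≤ℓ))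
      (S.trans (solve 4 (λ t a b c → (t :* a) :* (b :* c) := (t :* b) :* (a :* c)) S.refl (tpow 1) g (tpow r) (Φ r))
        (⊛-congʳ (G r) (S.sym (tpow-+ 1 r))))

    baseColumn-order : ∀ r → r ≤ℕ ℓ → OrderAtLeast (suc r) (baseColumn r)
    baseColumn-order r r≤ℓ = OrderAtLeast-cong (S.sym (baseColumn-factor r r≤ℓ)) (tpow-⊛-order (suc r) (G r))

    column-order : ∀ k → OrderAtLeast k (column k)
    column-order zero    n ()
    column-order (suc k) = P.subst (λ k′ → OrderAtLeast (suc k′) (column (suc k′))) (P.sym k≡r+ℓq)
      (OrderAtLeast-cong (S.sym (column-factor r q r≤L))
        (OrderAtLeast-weaken (ℕ.≤-reflexive (P.cong (λ x → suc (r +ℕ x)) (ℕ.*-comm ℓ q)))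
          (OrderAtLeast-⊛ (suc r) (q *ℕ ℓ) (baseColumn r) (pow F q)
            (baseColumn-order r (ℕ.m≤n⇒m≤1+n r≤L)) (OrderAtLeast-pow ℓ F q F-order))))
      where
      r q : ℕ
      r = k % ℓ
      q = k / ℓ
      r≤L : r ≤ℕ L
      r≤L = ℕ.≤-pred (m%n<n k ℓ)
      k≡r+ℓq : k ≡ r +ℕ ℓ *ℕ q
      k≡r+ℓq = P.trans (m≡m%n+[m/n]*n k ℓ) (P.cong (r +ℕ_) (ℕ.*-comm q ℓ))

    d-above-diagonal : ∀ {N k} → N <ℕ k → d N k ≈ 0#
    d-above-diagonal {N} {k} N<k = column-order k N N<k

    comp-dilated : ∀ z → Dilated (comp z F) (comp z X)
    comp-dilated z = Dilated-comp z F-dilated F₀≈0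

    relation-series : ∀ r z V → r ≤ℕ L → (∀ n → V n ≈ Σ< (suc n) (λ j → z j * d n (suc (r +ℕ ℓ *ℕ j)))) →
      V ≋ baseColumn r ⊛ comp z F
    relation-series r z V r≤L V≈Σ n = trans (V≈Σ n)
      (trans (Σ<-cong (suc n) (λ j → *-cong refl (column-factor r j r≤L n))) (sym (⊛-comp (baseColumn r) z F F₀≈0 n)))

    -- the j = 0 term lies in column 0, which is b; column ℓ j = column ℓ · F^(j-1) for j ≥ 1
    relation-series-multiples : ∀ z V → (∀ n → V n ≈ Σ< (suc n) (λ j → z j * d n (ℓ *ℕ j))) →
      V ≋ const (z 0) ⊛ b ⊕ baseColumn L ⊛ comp (tail z) F
    relation-series-multiples z V V≈Σ n = begin
      V n
        ≈⟨ V≈Σ n ⟩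
      Σ< (suc n) term
        ≈⟨ Σ<-head n term ⟩
      term 0 + Σ< n (λ j → term (suc j))
        ≈⟨ +-cong (*-cong refl (reflexive (P.cong (d n) (ℕ.*-zeroʳ ℓ))))
                  (sym (Σ<-truncate _ (ℕ.n≤1+n n) (λ j n≤j → trans (*-cong refl (beyond j n≤j)) (zeroʳ _)))) ⟩
      z 0 * b n + Σ< (suc n) (λ j → term (suc j))
        ≈⟨ +-cong (sym (const-⊛ (z 0) b n))
                  (Σ<-cong (suc n) (λ j → *-cong refl (reflexive (P.cong (d n) (ℕ.*-suc ℓ j))))) ⟩
      (const (z 0) ⊛ b) n + Σ< (suc n) (λ j → tail z j * d n (suc (L +ℕ ℓ *ℕ j)))
        ≈⟨ +-cong refl (relation-series L (tail z) _ ℕ.≤-refl (λ _ → refl) n) ⟩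
      (const (z 0) ⊛ b) n + (baseColumn L ⊛ comp (tail z) F) n ∎
      where
      open import Relation.Binary.Reasoning.Setoid setoid
      term : ℕ → Carrier
      term j = z j * d n (ℓ *ℕ j)
      beyond : ∀ j → n ≤ℕ j → d n (ℓ *ℕ suc j) ≈ 0#
      beyond j n≤j = d-above-diagonal (ℕ.<-≤-trans (s≤s n≤j) (ℕ.m≤n*m (suc j) ℓ))

    baseColumn-last-factor : baseColumn L ≋ tpow ℓ ⊛ G L
    baseColumn-last-factor = baseColumn-factor L (ℕ.n≤1+n L)

    baseColumn-tail : ∀ r → r <ℕ L → shift (tpow (suc r) ⊛ (G r ⊖ const (G r 0))) ℓ ≋ shift (baseColumn r) ℓ
    baseColumn-tail r r<L n = begin
        (tpow (suc r) ⊛ (G r ⊖ const (G r 0))) (n +ℕ ℓ)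
          ≈⟨ ⊛-⊖ (tpow (suc r)) (G r) (const (G r 0)) (n +ℕ ℓ) ⟩
        (tpow (suc r) ⊛ G r) (n +ℕ ℓ) - (tpow (suc r) ⊛ const (G r 0)) (n +ℕ ℓ)
          ≈⟨ +-cong (sym (baseColumn-factor r (ℕ.≤-trans (ℕ.<⇒≤ r<L) (ℕ.n≤1+n L)) (n +ℕ ℓ)))
                    (-‿cong constant-vanishes) ⟩
        baseColumn r (n +ℕ ℓ) - 0#
          ≈⟨ trans (+-cong refl -0#≈0#) (+-identityʳ _) ⟩
        baseColumn r (n +ℕ ℓ) ∎
      where
      open import Relation.Binary.Reasoning.Setoid setoid
      r+1≢n+ℓ : suc r ≢ n +ℕ ℓ
      r+1≢n+ℓ = ℕ.<⇒≢ (ℕ.<-≤-trans (s≤s r<L) (ℕ.m≤n+m ℓ n))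
      constant-vanishes : (tpow (suc r) ⊛ const (G r 0)) (n +ℕ ℓ) ≈ 0#
      constant-vanishes = trans (⊛-comm (tpow (suc r)) _ (n +ℕ ℓ)) (trans (const-⊛ _ (tpow (suc r)) (n +ℕ ℓ))
        (trans (*-cong refl (tpow-off (suc r) (n +ℕ ℓ) r+1≢n+ℓ)) (zeroʳ _)))

    -- G r − G r(0) lies in t^ℓ K[[t^ℓ]], and t^(r+1) (G r − G r(0)) agrees with column r + 1 from degree ℓ on
    Z-series : ∀ r z → r <ℕ L → IsZSeq (suc r) z → G r ⊖ const (G r 0) ≋ tpow ℓ ⊛ G r ⊛ comp z F
    Z-series r z r<L rel = tpow-⊛-cancel (suc r) W _ (begin
      tpow (suc r) ⊛ W                            ≈⟨ factor-shift ℓ _ tW-order ⟩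
      tpow ℓ ⊛ shift (tpow (suc r) ⊛ W) ℓ         ≈⟨ ⊛-congˡ (tpow ℓ) (baseColumn-tail r r<L) ⟩
      tpow ℓ ⊛ shift (baseColumn r) ℓ             ≈⟨ ⊛-congˡ (tpow ℓ) relation ⟩
      tpow ℓ ⊛ (baseColumn r ⊛ comp z F)          ≈⟨ ⊛-congˡ (tpow ℓ) (⊛-congʳ (comp z F) (baseColumn-factor r r≤ℓ)) ⟩
      tpow ℓ ⊛ (tpow (suc r) ⊛ G r ⊛ comp z F)    ≈⟨ solve 4 (λ a t b c → a :* ((t :* b) :* c) := t :* (a :* b :* c))
                                                        S.refl (tpow ℓ) (tpow (suc r)) (G r) (comp z F) ⟩
      tpow (suc r) ⊛ (tpow ℓ ⊛ G r ⊛ comp z F)    ∎)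
      where
      open import Relation.Binary.Reasoning.Setoid S.setoid
      r≤L : r ≤ℕ L
      r≤L = ℕ.<⇒≤ r<L
      r≤ℓ : r ≤ℕ ℓ
      r≤ℓ = ℕ.m≤n⇒m≤1+n r≤L
      W : Series
      W = G r ⊖ const (G r 0)
      tW-order : OrderAtLeast ℓ (tpow (suc r) ⊛ W)
      tW-order = OrderAtLeast-weaken (ℕ.m≤n+m ℓ (suc r))
        (OrderAtLeast-⊛ (suc r) ℓ (tpow (suc r)) W (tpow-order (suc r))
          (Dilated-order (Dilated-⊖ (G-dilated r r≤ℓ) (Dilated-const _)) (-‿inverseʳ _)))
      relation : shift (baseColumn r) ℓ ≋ baseColumn r ⊛ comp z F
      relation = S.trans (shift-cong ℓ (S.sym (column-base r r≤L))) (relation-series r z _ r≤L rel)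

    Z-identity : ∀ r z → r <ℕ L → IsZSeq (suc r) z → Ĝ r ⊖ const (G r 0) ≋ tpow 1 ⊛ Ĝ r ⊛ comp z X
    Z-identity r z r<L rel = Dilated-unique
      (Dilated-⊖ (G-dilated r r≤ℓ) (Dilated-const _))
      (Dilated-cong (S.sym (Z-series r z r<L rel)) S.refl
        (Dilated-⊛ (Dilated-⊛ tpow-ℓ-dilated (G-dilated r r≤ℓ)) (comp-dilated z)))
      where
      r≤ℓ : r ≤ℕ ℓ
      r≤ℓ = ℕ.≤-trans (ℕ.<⇒≤ r<L) (ℕ.n≤1+n L)

    multiples-series-coeff₀ : ∀ a v → (const a ⊛ b ⊕ tpow ℓ ⊛ G L ⊛ v) 0 ≈ a * b 0
    multiples-series-coeff₀ a v = trans (+-cong (⊛-coeff₀ (const a) b) higher-terms) (+-identityʳ _)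
      where
      higher-terms : (tpow ℓ ⊛ G L ⊛ v) 0 ≈ 0#
      higher-terms = trans (⊛-coeff₀ (tpow ℓ ⊛ G L) v)
        (trans (*-cong (tpow-⊛-order ℓ (G L) 0 (s≤s z≤n)) refl) (zeroˡ _))

    multiples-series-dilated : ∀ a v →
      Dilated (const a ⊛ b ⊕ tpow ℓ ⊛ G L ⊛ comp v F) (const a ⊛ bhat ⊕ tpow 1 ⊛ Ĝ L ⊛ comp v X)
    multiples-series-dilated a v = Dilated-⊕ (Dilated-⊛ (Dilated-const a) b-dilated)
      (Dilated-⊛ (Dilated-⊛ tpow-ℓ-dilated (G-dilated L (ℕ.n≤1+n L))) (comp-dilated v))

    Zℓ-series : ∀ z → IsZℓSeq z → G L ≋ const (z 0) ⊛ b ⊕ tpow ℓ ⊛ G L ⊛ comp (tail z) F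
    Zℓ-series z rel = begin
      G L                                                    ≈⟨ shift-tpow-⊛ ℓ (G L) ⟨
      shift (tpow ℓ ⊛ G L) ℓ                                 ≈⟨ shift-cong ℓ (S.sym baseColumn-last-factor) ⟩
      shift (baseColumn L) ℓ                                 ≈⟨ shift-cong ℓ (S.sym (column-base L ℕ.≤-refl)) ⟩
      shift (column ℓ) ℓ                                     ≈⟨ relation-series-multiples z _ rel ⟩
      const (z 0) ⊛ b ⊕ baseColumn L ⊛ comp (tail z) F
        ≈⟨ ⊕-cong S.refl (⊛-congʳ (comp (tail z) F) baseColumn-last-factor) ⟩
      const (z 0) ⊛ b ⊕ tpow ℓ ⊛ G L ⊛ comp (tail z) F       ∎
      where open import Relation.Binary.Reasoning.Setoid S.setoid

    Zℓ-identity : ∀ z → IsZℓSeq z → Ĝ L ≋ const (z 0) ⊛ bhat ⊕ tpow 1 ⊛ Ĝ L ⊛ comp (tail z) X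
    Zℓ-identity z rel = Dilated-unique (G-dilated L (ℕ.n≤1+n L))
      (Dilated-cong (S.sym (Zℓ-series z rel)) S.refl (multiples-series-dilated (z 0) (tail z)))

    Zℓ-coeff₀ : ∀ z → IsZℓSeq z → z 0 * b 0 ≈ g 0 * Π< L c'
    Zℓ-coeff₀ z rel =
      trans (sym (multiples-series-coeff₀ (z 0) (comp (tail z) F))) (trans (sym (Zℓ-series z rel 0)) (G-coeff₀ L))

    W-series : ∀ w → IsWSeq w → shift b ℓ ≋ const (w 0) ⊛ b ⊕ tpow ℓ ⊛ G L ⊛ comp (tail w) F
    W-series w rel = S.trans (relation-series-multiples w _ rel)
      (⊕-cong S.refl (⊛-congʳ (comp (tail w) F) baseColumn-last-factor))

    W-coeff₀ : ∀ w → IsWSeq w → w 0 * b 0 ≈ b ℓ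
    W-coeff₀ w rel = trans (sym (multiples-series-coeff₀ (w 0) (comp (tail w) F))) (sym (W-series w rel 0))

    W-identity : ∀ w → IsWSeq w →
      bhat ⊖ const (b 0) ≋ tpow 1 ⊛ (const (w 0) ⊛ bhat ⊕ tpow 1 ⊛ Ĝ L ⊛ comp (tail w) X)
    W-identity w rel = Dilated-unique B-dilated
      (Dilated-cong (S.sym B-series) S.refl (Dilated-⊛ tpow-ℓ-dilated (multiples-series-dilated (w 0) (tail w))))
      where
      B-dilated : Dilated (b ⊖ const (b 0)) (bhat ⊖ const (b 0))
      B-dilated = Dilated-⊖ b-dilated (Dilated-const (b 0))
      B-tail : shift (b ⊖ const (b 0)) ℓ ≋ shift b ℓ
      B-tail n = trans (+-cong refl (trans (-‿cong (reflexive (P.cong (const (b 0)) (ℕ.+-suc n L)))) -0#≈0#))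
                       (+-identityʳ _)
      B-series : b ⊖ const (b 0) ≋ tpow ℓ ⊛ (const (w 0) ⊛ b ⊕ tpow ℓ ⊛ G L ⊛ comp (tail w) F)
      B-series = S.trans (factor-shift ℓ _ (Dilated-order B-dilated (-‿inverseʳ _)))
        (⊛-congˡ (tpow ℓ) (S.trans B-tail (W-series w rel)))

    baseColumn₀-cancel : ∀ {y} → g 0 * y ≈ 1# → ∀ u v → baseColumn 0 ⊛ u ≋ baseColumn 0 ⊛ v → u ≋ v
    baseColumn₀-cancel {y} g₀y≈1 u v lu≈lv = unit-⊛-cancel (G 0) y u v
      (trans (*-cong (trans (G-coeff₀ 0) (*-identityʳ _)) refl) g₀y≈1)
      (tpow-⊛-cancel 1 _ _ (S.trans (S.sym (⊛-assoc (tpow 1) (G 0) u))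
        (S.trans (⊛-congʳ u (S.sym (baseColumn-factor 0 z≤n)))
          (S.trans lu≈lv (S.trans (⊛-congʳ v (baseColumn-factor 0 z≤n)) (⊛-assoc (tpow 1) (G 0) v))))))

    A-relation : ∀ A → IsASeq A → ∀ N q → ℓ <ℕ q +ℕ ℓ →
      d (N +ℕ ℓ) (q +ℕ ℓ) ≈ Σ< (suc N) (λ j → A j * d N (q +ℕ ℓ *ℕ j))
    A-relation A rel N q ℓ<q+ℓ = trans (rel N (q +ℕ ℓ) ℓ<q+ℓ)
      (Σ<-cong (suc N) (λ j → *-cong refl (reflexive (P.cong (λ x → d N (x +ℕ ℓ *ℕ j)) (ℕ.m+n∸n≡m q ℓ)))))

    -- column ℓ + 1 is t g F, and the A-relation at that column reads t g F / t^ℓ = t g A(F)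
    A-series : ∀ {y} → g 0 * y ≈ 1# → ∀ A → IsASeq A → Φ ℓ ≋ comp A F
    A-series g₀y≈1 A rel = baseColumn₀-cancel g₀y≈1 (Φ ℓ) (comp A F) (begin
      baseColumn 0 ⊛ Φ ℓ                       ≈⟨ shift-tpow-⊛ ℓ _ ⟨
      shift (tpow ℓ ⊛ (baseColumn 0 ⊛ Φ ℓ)) ℓ  ≈⟨ shift-cong ℓ (S.sym column-ℓ+1) ⟩
      shift (column (suc ℓ)) ℓ                 ≈⟨ relation-series 0 A _ z≤n (λ n → A-relation A rel n 1 ℓ<1+ℓ) ⟩
      baseColumn 0 ⊛ comp A F                  ∎)
      where
      open import Relation.Binary.Reasoning.Setoid S.setoid
      ℓ<1+ℓ : ℓ <ℕ 1 +ℕ ℓ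
      ℓ<1+ℓ = ℕ.n<1+n ℓ
      column-ℓ+1 : column (suc ℓ) ≋ tpow ℓ ⊛ (baseColumn 0 ⊛ Φ ℓ)
      column-ℓ+1 = S.trans (S.reflexive (P.cong (λ k → column (suc k)) (P.sym (ℕ.*-identityʳ ℓ))))
        (S.trans (column-factor 0 1 z≤n)
          (S.trans (⊛-congˡ (baseColumn 0) (S.trans (⊛-one F) (prefix-factor ℓ ℕ.≤-refl)))
            (solve 3 (λ c t f → c :* (t :* f) := t :* (c :* f)) S.refl (baseColumn 0) (tpow ℓ) (Φ ℓ))))

    A-identity : ∀ {y} → g 0 * y ≈ 1# → ∀ A → IsASeq A → Ψ ℓ ≋ comp A X
    A-identity g₀y≈1 A rel = Dilated-unique (Φ-dilated ℓ ℕ.≤-refl)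
      (Dilated-cong (S.sym (A-series g₀y≈1 A rel)) S.refl (comp-dilated A))

    X₀≈0 : X 0 ≈ 0#
    X₀≈0 = trans (X-factor 0) (tpow-⊛-order 1 (Ψ ℓ) 0 (s≤s z≤n))

    A-gf : ∀ {y} → g 0 * y ≈ 1# → ∀ A → IsASeq A → tpow ℓ ⊛ comp A X ≋ Fhat
    A-gf g₀y≈1 A rel = S.sym (S.trans (fhat-prefix-factor ℓ) (⊛-congˡ (tpow ℓ) (A-identity g₀y≈1 A rel)))

    Z₁-gf : ∀ z → 0 <ℕ L → IsZSeq 1 z → tpow 1 ⊛ ghat ⊛ comp z X ≋ ghat ⊖ const (g 0)
    Z₁-gf z 0<L rel = S.trans (⊛-congʳ (comp z X) (⊛-congˡ (tpow 1) (S.sym (⊛-one ghat))))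
      (S.trans (S.sym (Z-identity 0 z 0<L rel))
        (⊖-cong (⊛-one ghat) (const-cong (trans (G-coeff₀ 0) (*-identityʳ _)))))

    Z-gf : ∀ r z → r <ℕ L → IsZSeq (suc r) z →
      tpow 1 ⊛ (ghat ⊛ ΠS r fhat) ⊛ comp z X ≋ ghat ⊛ ΠS r fhat ⊖ const (g 0 * Π< r c') ⊛ tpow r
    Z-gf r z r<L rel = begin
      tpow 1 ⊛ (ghat ⊛ ΠS r fhat) ⊛ comp z X
        ≈⟨ ⊛-congʳ (comp z X) (⊛-congˡ (tpow 1) (⊛-congˡ ghat (fhat-prefix-factor r))) ⟩
      tpow 1 ⊛ (ghat ⊛ (tpow r ⊛ Ψ r)) ⊛ comp z X
        ≈⟨ solve 5 (λ t a b c e → t :* (a :* (b :* c)) :* e := b :* (t :* (a :* c) :* e))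
             S.refl (tpow 1) ghat (tpow r) (Ψ r) (comp z X) ⟩
      tpow r ⊛ (tpow 1 ⊛ Ĝ r ⊛ comp z X)
        ≈⟨ ⊛-congˡ (tpow r) (S.sym (Z-identity r z r<L rel)) ⟩
      tpow r ⊛ (Ĝ r ⊖ const (G r 0))
        ≈⟨ ⊛-⊖ (tpow r) (Ĝ r) (const (G r 0)) ⟩
      tpow r ⊛ Ĝ r ⊖ tpow r ⊛ const (G r 0)
        ≈⟨ ⊖-cong (S.trans (solve 3 (λ t a c → t :* (a :* c) := a :* (t :* c)) S.refl (tpow r) ghat (Ψ r))
                           (⊛-congˡ ghat (S.sym (fhat-prefix-factor r))))
                  (S.trans (⊛-comm (tpow r) (const (G r 0))) (⊛-congʳ (tpow r) (const-cong (G-coeff₀ r)))) ⟩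
      ghat ⊛ ΠS r fhat ⊖ const (g 0 * Π< r c') ⊛ tpow r ∎
      where open import Relation.Binary.Reasoning.Setoid S.setoid

    comp-⊖-head-factor : ∀ z → comp z X ⊖ const (z 0) ≋ (tpow 1 ⊛ (Ψ L ⊛ ψ L)) ⊛ comp (tail z) X
    comp-⊖-head-factor z = S.trans (comp-head z X X₀≈0) (⊛-congʳ (comp (tail z) X) X-factor)

    Zℓ-gf : ∀ z → IsZℓSeq z →
      tpow ℓ ⊛ ghat ⊛ (comp z X ⊖ const (z 0)) ≋ fhat L ⊛ (ghat ⊛ ΠS L fhat ⊖ const (z 0) ⊛ tpow L ⊛ bhat)
    Zℓ-gf z rel = begin
      tpow ℓ ⊛ ghat ⊛ (comp z X ⊖ const (z 0))
        ≈⟨ ⊛-cong (⊛-congʳ ghat tpow-ℓ) (comp-⊖-head-factor z) ⟩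
      (tpow L ⊛ tpow 1) ⊛ ghat ⊛ ((tpow 1 ⊛ (Ψ L ⊛ ψ L)) ⊛ comp (tail z) X)
        ≈⟨ solve 6 (λ tL t gh ph ps cz → (tL :* t) :* gh :* ((t :* (ph :* ps)) :* cz)
                                       := (t :* ps) :* (tL :* (t :* (gh :* ph) :* cz)))
             S.refl (tpow L) (tpow 1) ghat (Ψ L) (ψ L) (comp (tail z) X) ⟩
      (tpow 1 ⊛ ψ L) ⊛ (tpow L ⊛ H)
        ≈⟨ ⊛-cong (S.sym (fhat-factor L)) (S.sym (⊖-intro identity-times-tᴸ)) ⟩
      fhat L ⊛ (ghat ⊛ ΠS L fhat ⊖ const (z 0) ⊛ tpow L ⊛ bhat) ∎
      where
      open import Relation.Binary.Reasoning.Setoid S.setoid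
      H : Series
      H = tpow 1 ⊛ Ĝ L ⊛ comp (tail z) X
      identity-times-tᴸ : ghat ⊛ ΠS L fhat ≋ tpow L ⊛ H ⊕ const (z 0) ⊛ tpow L ⊛ bhat
      identity-times-tᴸ = S.trans (⊛-congˡ ghat (fhat-prefix-factor L))
        (S.trans (solve 3 (λ a t c → a :* (t :* c) := t :* (a :* c)) S.refl ghat (tpow L) (Ψ L))
          (S.trans (⊛-congˡ (tpow L) (Zℓ-identity z rel))
            (solve 4 (λ t c bh w → t :* (c :* bh :+ w) := t :* w :+ c :* t :* bh) S.refl (tpow L) (const (z 0)) bhat H)))

    W-gf : ∀ w → IsWSeq w →
      tpow 2 ⊛ ghat ⊛ (comp w X ⊖ const (w 0)) ≋ fhat L ⊛ (bhat ⊛ (one ⊖ const (w 0) ⊛ tpow 1) ⊖ const (b 0))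
    W-gf w rel = begin
      tpow 2 ⊛ ghat ⊛ (comp w X ⊖ const (w 0))
        ≈⟨ ⊛-cong (⊛-congʳ ghat (tpow-+ 1 1)) (comp-⊖-head-factor w) ⟩
      (tpow 1 ⊛ tpow 1) ⊛ ghat ⊛ ((tpow 1 ⊛ (Ψ L ⊛ ψ L)) ⊛ comp (tail w) X)
        ≈⟨ solve 5 (λ t gh ph ps cz → (t :* t) :* gh :* ((t :* (ph :* ps)) :* cz)
                                    := (t :* ps) :* (t :* (t :* (gh :* ph) :* cz)))
             S.refl (tpow 1) ghat (Ψ L) (ψ L) (comp (tail w) X) ⟩
      (tpow 1 ⊛ ψ L) ⊛ (tpow 1 ⊛ H)
        ≈⟨ ⊛-cong (S.sym (fhat-factor L)) (S.sym rearranged) ⟩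
      fhat L ⊛ (bhat ⊛ (one ⊖ Q) ⊖ const (b 0)) ∎
      where
      open import Relation.Binary.Reasoning.Setoid S.setoid
      H Q : Series
      H = tpow 1 ⊛ Ĝ L ⊛ comp (tail w) X
      Q = const (w 0) ⊛ tpow 1
      rearranged : bhat ⊛ (one ⊖ Q) ⊖ const (b 0) ≋ tpow 1 ⊛ H
      rearranged = ⊖-intro (S.trans (⊛-⊖ bhat one Q) (S.trans (⊖-cong (⊛-one bhat) S.refl)
        (⊖-intro (S.trans (⊖-elim (W-identity w rel))
          (solve 5 (λ t c bh h cb → t :* (c :* bh :+ h) :+ cb := (t :* h :+ cb) :+ bh :* (c :* t))
            S.refl (tpow 1) (const (w 0)) bhat H (const (b 0)))))))

    open CompressionIndex L using (row-high; row-high-lower; row-low; row-entry)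

    dhat-at : ∀ {n k} N → L *ℕ k +ℕ N ≡ ℓ *ℕ n → dhat n k ≈ d N k
    dhat-at {n} {k} N Lk+N≡ℓn =
      P.subst (λ x → (if L *ℕ k ≤ᵇ x then d (x ∸ L *ℕ k) k else 0#) ≈ d N k) Lk+N≡ℓn (in-range (L *ℕ k))
      where
      in-range : ∀ m → (if m ≤ᵇ m +ℕ N then d (m +ℕ N ∸ m) k else 0#) ≈ d N k
      in-range m with m ≤ᵇ (m +ℕ N) | ℕ.≤⇒≤ᵇ (ℕ.m≤m+n m N)
      ... | true | _ = reflexive (P.cong (λ x → d x k) (ℕ.m+n∸m≡n m N))

    -- both sums vanish beyond j = p, where the column m + ℓ j exceeds the row m + ℓ p
    Σ<-compress : ∀ (z : Series) m p {n} → p ≤ℕ n →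
      Σ< (suc (m +ℕ ℓ *ℕ p)) (λ j → z j * d (m +ℕ ℓ *ℕ p) (m +ℕ ℓ *ℕ j))
        ≈ Σ< (suc n) (λ j → z j * dhat ((m +ℕ p) +ℕ j *ℕ L) (m +ℕ ℓ *ℕ j))
    Σ<-compress z m p {n} p≤n = begin
      Σ< (suc N) (λ j → z j * d N (m +ℕ ℓ *ℕ j))
        ≈⟨ Σ<-truncate _ (s≤s p≤N) (λ j p<j → trans (*-cong refl (vanishes j p<j)) (zeroʳ _)) ⟩
      Σ< (suc p) (λ j → z j * d N (m +ℕ ℓ *ℕ j))
        ≈⟨ Σ<-cong (suc p) (λ j → *-cong refl (sym (entry j))) ⟩
      Σ< (suc p) (λ j → z j * dhat ((m +ℕ p) +ℕ j *ℕ L) (m +ℕ ℓ *ℕ j))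
        ≈⟨ Σ<-truncate _ (s≤s p≤n) (λ j p<j → trans (*-cong refl (trans (entry j) (vanishes j p<j))) (zeroʳ _)) ⟨
      Σ< (suc n) (λ j → z j * dhat ((m +ℕ p) +ℕ j *ℕ L) (m +ℕ ℓ *ℕ j)) ∎
      where
      open import Relation.Binary.Reasoning.Setoid setoid
      N : ℕ
      N = m +ℕ ℓ *ℕ p
      p≤N : p ≤ℕ N
      p≤N = ℕ.≤-trans (ℕ.m≤n*m p ℓ) (ℕ.m≤n+m (ℓ *ℕ p) m)
      vanishes : ∀ j → p <ℕ j → d N (m +ℕ ℓ *ℕ j) ≈ 0#
      vanishes j p<j = d-above-diagonal (ℕ.+-monoʳ-< m (ℕ.*-monoʳ-< ℓ p<j))
      entry : ∀ j → dhat ((m +ℕ p) +ℕ j *ℕ L) (m +ℕ ℓ *ℕ j) ≈ d N (m +ℕ ℓ *ℕ j)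
      entry j = dhat-at N (row-entry m p j)

    Σ<-dhat-cong : ∀ n (z : Series) (row col col′ : ℕ → ℕ) → (∀ j → col j ≡ col′ j) →
      Σ< n (λ j → z j * dhat (row j) (col j)) ≈ Σ< n (λ j → z j * dhat (row j) (col′ j))
    Σ<-dhat-cong n z row col col′ col≡col′ =
      Σ<-cong n (λ j → *-cong refl (reflexive (P.cong (dhat (row j)) (col≡col′ j))))

    A-compressed : ∀ A → IsASeq A → ∀ n k → ℓ <ℕ k → k ≤ℕ n →
      dhat n k ≈ Σ< (suc n) (λ j → A j * dhat ((n ∸ ℓ) +ℕ j *ℕ L) ((k ∸ ℓ) +ℕ ℓ *ℕ j))
    A-compressed A rel n k ℓ<k k≤n =
      P.subst₂ Recurrence n≡ k≡ (at (k ∸ ℓ) (n ∸ k) (P.subst (ℓ <ℕ_) (P.sym k≡) ℓ<k))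
      where
      Recurrence : ℕ → ℕ → Set c′
      Recurrence n k = dhat n k ≈ Σ< (suc n) (λ j → A j * dhat ((n ∸ ℓ) +ℕ j *ℕ L) ((k ∸ ℓ) +ℕ ℓ *ℕ j))
      k≡ : k ∸ ℓ +ℕ ℓ ≡ k
      k≡ = ℕ.m∸n+n≡m (ℕ.<⇒≤ ℓ<k)
      n≡ : k ∸ ℓ +ℕ ℓ +ℕ (n ∸ k) ≡ n
      n≡ = P.trans (P.cong (_+ℕ (n ∸ k)) k≡) (ℕ.m+[n∸m]≡n k≤n)
      at : ∀ q p → ℓ <ℕ q +ℕ ℓ → Recurrence (q +ℕ ℓ +ℕ p) (q +ℕ ℓ)
      at q p ℓ<q+ℓ rewrite ℕ.m+n∸n≡m q ℓ | row-high-lower q p = begin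
        dhat (q +ℕ ℓ +ℕ p) (q +ℕ ℓ)
          ≈⟨ dhat-at _ (row-high q p) ⟩
        d (q +ℕ ℓ *ℕ p +ℕ ℓ) (q +ℕ ℓ)
          ≈⟨ A-relation A rel (q +ℕ ℓ *ℕ p) q ℓ<q+ℓ ⟩
        Σ< (suc (q +ℕ ℓ *ℕ p)) (λ j → A j * d (q +ℕ ℓ *ℕ p) (q +ℕ ℓ *ℕ j))
          ≈⟨ Σ<-compress A q p (ℕ.m≤n+m p (q +ℕ ℓ)) ⟩
        Σ< (suc (q +ℕ ℓ +ℕ p)) (λ j → A j * dhat ((q +ℕ p) +ℕ j *ℕ L) (q +ℕ ℓ *ℕ j)) ∎
        where open import Relation.Binary.Reasoning.Setoid setoid

    Zℓ-compressed : ∀ z → IsZℓSeq z → ∀ n → ℓ ≤ℕ n →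
      dhat n ℓ ≈ Σ< (suc n) (λ j → z j * dhat ((n ∸ ℓ) +ℕ j *ℕ L) (j *ℕ ℓ))
    Zℓ-compressed z rel n ℓ≤n = P.subst Recurrence (ℕ.m+[n∸m]≡n ℓ≤n) (at (n ∸ ℓ))
      where
      open import Relation.Binary.Reasoning.Setoid setoid
      Recurrence : ℕ → Set c′
      Recurrence n = dhat n ℓ ≈ Σ< (suc n) (λ j → z j * dhat ((n ∸ ℓ) +ℕ j *ℕ L) (j *ℕ ℓ))
      at : ∀ p → Recurrence (ℓ +ℕ p)
      at p rewrite ℕ.m+n∸m≡n ℓ p = begin
        dhat (ℓ +ℕ p) ℓ                                             ≈⟨ dhat-at _ (row-high 0 p) ⟩
        d (ℓ *ℕ p +ℕ ℓ) ℓ                                           ≈⟨ rel (ℓ *ℕ p) ⟩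
        Σ< (suc (ℓ *ℕ p)) (λ j → z j * d (ℓ *ℕ p) (ℓ *ℕ j))         ≈⟨ Σ<-compress z 0 p (ℕ.m≤n+m p ℓ) ⟩
        Σ< (suc (ℓ +ℕ p)) (λ j → z j * dhat (p +ℕ j *ℕ L) (ℓ *ℕ j))
          ≈⟨ Σ<-dhat-cong (suc (ℓ +ℕ p)) z (λ j → p +ℕ j *ℕ L) _ _ (ℕ.*-comm ℓ) ⟩
        Σ< (suc (ℓ +ℕ p)) (λ j → z j * dhat (p +ℕ j *ℕ L) (j *ℕ ℓ)) ∎

    W-compressed : ∀ w → IsWSeq w → ∀ n → 1 ≤ℕ n →
      dhat n 0 ≈ Σ< (suc n) (λ j → w j * dhat ((n ∸ 1) +ℕ j *ℕ L) (j *ℕ ℓ))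
    W-compressed w rel (suc p) _ = begin
      dhat (suc p) 0                                              ≈⟨ dhat-at _ (row-low 0 p) ⟩
      d (ℓ *ℕ p +ℕ ℓ) 0                                           ≈⟨ rel (ℓ *ℕ p) ⟩
      Σ< (suc (ℓ *ℕ p)) (λ j → w j * d (ℓ *ℕ p) (ℓ *ℕ j))         ≈⟨ Σ<-compress w 0 p (ℕ.n≤1+n p) ⟩
      Σ< (suc (suc p)) (λ j → w j * dhat (p +ℕ j *ℕ L) (ℓ *ℕ j))
        ≈⟨ Σ<-dhat-cong (suc (suc p)) w (λ j → p +ℕ j *ℕ L) _ _ (ℕ.*-comm ℓ) ⟩
      Σ< (suc (suc p)) (λ j → w j * dhat (p +ℕ j *ℕ L) (j *ℕ ℓ))  ∎
      where open import Relation.Binary.Reasoning.Setoid setoid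

    Z-compressed : ∀ m z → IsZSeq m z → ∀ n → m +ℕ 1 ≤ℕ n →
      dhat n m ≈ Σ< (suc n) (λ j → z j * dhat ((n ∸ 1) +ℕ j *ℕ L) (j *ℕ ℓ +ℕ m))
    Z-compressed m z rel n m+1≤n =
      P.subst Recurrence (ℕ.m+[n∸m]≡n (P.subst (_≤ℕ n) (ℕ.+-comm m 1) m+1≤n)) (at (n ∸ suc m))
      where
      open import Relation.Binary.Reasoning.Setoid setoid
      Recurrence : ℕ → Set c′
      Recurrence n = dhat n m ≈ Σ< (suc n) (λ j → z j * dhat ((n ∸ 1) +ℕ j *ℕ L) (j *ℕ ℓ +ℕ m))
      at : ∀ p → Recurrence (suc m +ℕ p)
      at p = begin
        dhat (suc m +ℕ p) m
          ≈⟨ dhat-at _ (row-low m p) ⟩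
        d (m +ℕ ℓ *ℕ p +ℕ ℓ) m
          ≈⟨ rel (m +ℕ ℓ *ℕ p) ⟩
        Σ< (suc (m +ℕ ℓ *ℕ p)) (λ j → z j * d (m +ℕ ℓ *ℕ p) (m +ℕ ℓ *ℕ j))
          ≈⟨ Σ<-compress z m p (ℕ.m≤n+m p (suc m)) ⟩
        Σ< (suc (suc m +ℕ p)) (λ j → z j * dhat ((m +ℕ p) +ℕ j *ℕ L) (m +ℕ ℓ *ℕ j))
          ≈⟨ Σ<-dhat-cong (suc (suc m +ℕ p)) z (λ j → (m +ℕ p) +ℕ j *ℕ L) _ _
               (λ j → P.trans (ℕ.+-comm m (ℓ *ℕ j)) (P.cong (_+ℕ m) (ℕ.*-comm ℓ j))) ⟩
        Σ< (suc (suc m +ℕ p)) (λ j → z j * dhat ((m +ℕ p) +ℕ j *ℕ L) (j *ℕ ℓ +ℕ m)) ∎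

theorem5p3 : ∀ {c r} (K : Field c r) →
  let open CommutativeRing (Field.commutativeRing K) in
  let open Setup (Field.commutativeRing K) in
  CharZero →
  (ℓ : ℕ) .{{_ : NonZero ℓ}} → 2 ≤ℕ ℓ →
  (b g : Series) (fs : ℕ → Series) →
  -- b, g ∈ K[[t^ℓ]], f_j ∈ t K[[t^ℓ]]
  (∀ n → ¬ (n % ℓ ≡ 0) → b n ≈ 0#) →
  (∀ n → ¬ (n % ℓ ≡ 0) → g n ≈ 0#) →
  (∀ j → j <ℕ ℓ → ∀ n → ¬ (n % ℓ ≡ 1) → fs j n ≈ 0#) →
  ¬ (b 0 ≈ 0#) → ¬ (g 0 ≈ 0#) →
  (∀ j → j <ℕ ℓ → ¬ (fs j 1 ≈ 0#)) →
  let open Array ℓ b g fs in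
  (A W : Series) (Z : ℕ → Series) →
  IsASeq A →
  (∀ m → 1 ≤ℕ m → m <ℕ ℓ → IsZSeq m (Z m)) →
  IsZℓSeq (Z ℓ) →
  IsWSeq W →
  -- generating-function identities (denominators cleared)
  ( (tpow ℓ ⊛ comp A X ≋ Fhat)
  × (tpow 1 ⊛ ghat ⊛ comp (Z 1) X ≋ ghat ⊖ const g₀)
  × (∀ m → 2 ≤ℕ m → m <ℕ ℓ →
       tpow 1 ⊛ (ghat ⊛ ΠS (m ∸ 1) fhat) ⊛ comp (Z m) X
         ≋ ghat ⊛ ΠS (m ∸ 1) fhat ⊖ const (g₀ * Π< (m ∸ 1) c') ⊛ tpow (m ∸ 1))
  × (Z ℓ 0 * b₀ ≈ g₀ * Π< (ℓ ∸ 1) c')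
  × (tpow ℓ ⊛ ghat ⊛ (comp (Z ℓ) X ⊖ const (Z ℓ 0))
       ≋ fhat (ℓ ∸ 1) ⊛ (ghat ⊛ ΠS (ℓ ∸ 1) fhat ⊖ const (Z ℓ 0) ⊛ tpow (ℓ ∸ 1) ⊛ bhat))
  × (W 0 * b₀ ≈ b ℓ)
  × (tpow 2 ⊛ ghat ⊛ (comp W X ⊖ const (W 0))
       ≋ fhat (ℓ ∸ 1) ⊛ (bhat ⊛ (one ⊖ const (W 0) ⊛ tpow 1) ⊖ const b₀))
  -- the equivalent recurrences for the compression
  × (∀ n k → ℓ <ℕ k → k ≤ℕ n →
       dhat n k ≈ Σ< (suc n) (λ j → A j * dhat ((n ∸ ℓ) +ℕ j *ℕ (ℓ ∸ 1)) ((k ∸ ℓ) +ℕ ℓ *ℕ j)))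
  × (∀ n → ℓ ≤ℕ n →
       dhat n ℓ ≈ Σ< (suc n) (λ j → Z ℓ j * dhat ((n ∸ ℓ) +ℕ j *ℕ (ℓ ∸ 1)) (j *ℕ ℓ)))
  × (∀ m n → 1 ≤ℕ m → m <ℕ ℓ → m +ℕ 1 ≤ℕ n →
       dhat n m ≈ Σ< (suc n) (λ j → Z m j * dhat ((n ∸ 1) +ℕ j *ℕ (ℓ ∸ 1)) (j *ℕ ℓ +ℕ m)))
  × (∀ n → 1 ≤ℕ n →
       dhat n 0 ≈ Σ< (suc n) (λ j → W j * dhat ((n ∸ 1) +ℕ j *ℕ (ℓ ∸ 1)) (j *ℕ ℓ))) )
theorem5p3 K _ (suc zero) (s≤s ())
theorem5p3 K _ ℓ@(suc (suc L)) _ b g fs b-sparse g-sparse fs-sparse _ g₀≉0 _ A W Z A-rel Z-rel Zℓ-rel W-rel =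
    A-gf g₀y≈1 A A-rel
  , Z₁-gf (Z 1) (s≤s z≤n) (Z-rel 1 ℕ.≤-refl (s≤s (s≤s z≤n)))
  , (λ { (suc r) (s≤s _) m<ℓ → Z-gf r (Z (suc r)) (ℕ.≤-pred m<ℓ) (Z-rel (suc r) (s≤s z≤n) m<ℓ) })
  , Zℓ-coeff₀ (Z ℓ) Zℓ-rel
  , Zℓ-gf (Z ℓ) Zℓ-rel
  , W-coeff₀ W W-rel
  , W-gf W W-rel
  , A-compressed A A-rel
  , Zℓ-compressed (Z ℓ) Zℓ-rel
  , (λ m n 1≤m m<ℓ → Z-compressed m (Z m) (Z-rel m 1≤m m<ℓ) n)
  , W-compressed W W-rel
  where
  open MultipleAlmostRiordan.Properties (Field.commutativeRing K) (suc L) b g fs b-sparse g-sparse fs-sparse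
  open CommutativeRing (Field.commutativeRing K) using (_*_; _≈_; 1#)
  g₀y≈1 : g 0 * proj₁ (Field.inverse K (g 0) g₀≉0) ≈ 1#
  g₀y≈1 = proj₂ (Field.inverse K (g 0) g₀≉0)
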